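{- Let $n_1,\dots,n_m$ be even integers with $n_i\ge 4$, and let $\mathcal{C}=\mathcal{C}(C_{n_1},\dots,C_{n_m})$ be the chain cycle obtained by identifying $v^i_{\frac{n_i}{2}+1}$ with $v^{i+1}_1$ for each $i=1,\dots,m-1$. Then the vertex cover number of the strong resolving graph of $\mathcal{C}$ is $\alpha(\mathcal{C}_{SR})=1+\sum_{i=1}^{m}\frac{n_i-2}{2}$.
   Context: The cycles $C_{n_1},\dots,C_{n_m}$ are pairwise disjoint, $V(C_{n_i})=\{v^i_1,\dots,v^i_{n_i}\}$ with $v^i_j$ adjacent to $v^i_{j+1}$ ($1\le j<n_i$) and $v^i_{n_i}$ adjacent to $v^i_1$; the chain cycle is obtained from their disjoint union by the stated identifications. In a connected graph $G$ with distance $d$, $u$ is maximally distant from $v$ if $d(v,w)\le d(u,v)$ for every neighbor $w$ of $u$; $u,v$ are mutually maximally distant if each is maximally distant from the other. The strong resolving graph $G_{SR}$ has vertex set $V(G)$, with $u,v$ adjacent iff $u$ and $v$ are mutually maximally distant in $G$. The vertex cover number $\alpha(H)$ is the minimum size of a set of vertices meeting every edge of $H$. -}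

module Defs where

open import Data.Nat using (ℕ; zero; suc; _+_; _∸_; _≤_)
open import Data.Nat.DivMod using (_/_)
open import Data.Fin using (Fin; toℕ)
open import Data.Fin.Subset using (Subset; _∈_; ∣_∣)
open import Data.Product using (Σ; _×_; ∃; _,_)
open import Data.Sum using (_⊎_)
open import Relation.Binary.PropositionalEquality using (_≡_)

Graph : ℕ → Set₁
Graph N = Fin N → Fin N → Set

data Walk {N : ℕ} (A : Graph N) : Fin N → Fin N → ℕ → Set where
  here : ∀ {u} → Walk A u u 0
  step : ∀ {u w v k} → A u w → Walk A w v k → Walk A u v (suc k)

Dist : ∀ {N} → Graph N → Fin N → Fin N → ℕ → Set
Dist A u v k = Walk A u v k × (∀ k′ → Walk A u v k′ → k ≤ k′)

MaxDistantFrom : ∀ {N} → Graph N → Fin N → Fin N → Set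
MaxDistantFrom A u v =
  ∀ w → A u w → ∀ a b → Dist A v w a → Dist A u v b → a ≤ b

MutuallyMaxDistant : ∀ {N} → Graph N → Fin N → Fin N → Set
MutuallyMaxDistant A u v = MaxDistantFrom A u v × MaxDistantFrom A v u

StrongResolvingGraph : ∀ {N} → Graph N → Graph N
StrongResolvingGraph A = MutuallyMaxDistant A

IsVertexCover : ∀ {N} → Graph N → Subset N → Set
IsVertexCover A S = ∀ u v → A u v → u ∈ S ⊎ v ∈ S

VertexCoverNumber : ∀ {N} → Graph N → ℕ → Set
VertexCoverNumber {N} A c =
  (Σ (Subset N) λ S → IsVertexCover A S × ∣ S ∣ ≡ c)
  × (∀ S → IsVertexCover A S → c ≤ ∣ S ∣)

-- Chain cycles.  Cycles are indexed by i : Fin m (m = suc k ≥ 1), cycle i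
-- has vertices j : Fin (n i), where j stands for v^{i+1}_{j+1} (0-based).

data EqClosure {A : Set} (R : A → A → Set) : A → A → Set where
  base  : ∀ {x y} → R x y → EqClosure R x y
  refl′ : ∀ {x} → EqClosure R x x
  sym′  : ∀ {x y} → EqClosure R x y → EqClosure R y x
  trans′ : ∀ {x y z} → EqClosure R x y → EqClosure R y z → EqClosure R x z

module _ {k : ℕ} (n : Fin (suc k) → ℕ) where

  CVert : Set
  CVert = Σ (Fin (suc k)) (λ i → Fin (n i))

  CycSucc : (c : ℕ) → Fin c → Fin c → Set
  CycSucc c j j′ = toℕ j′ ≡ suc (toℕ j) ⊎ (suc (toℕ j) ≡ c × toℕ j′ ≡ 0)

  data DisjAdj : CVert → CVert → Set where
    adj : ∀ {i j j′} → CycSucc (n i) j j′ ⊎ CycSucc (n i) j′ j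
        → DisjAdj (i , j) (i , j′)

  -- the stated identifications: v^i_{n_i/2 + 1} with v^{i+1}_1
  Ident : CVert → CVert → Set
  Ident (i , j) (i′ , j′) =
    toℕ i′ ≡ suc (toℕ i) × toℕ j ≡ n i / 2 × toℕ j′ ≡ 0

  -- π : CVert → Fin N realises the quotient by the identifications:
  -- surjective, and identifying exactly the equivalence closure of Ident.
  IsChainQuotient : ∀ {N} → (CVert → Fin N) → Set
  IsChainQuotient {N} π =
    (∀ u → ∃ λ x → π x ≡ u)
    × (∀ x y → (π x ≡ π y → EqClosure Ident x y)
                × (EqClosure Ident x y → π x ≡ π y))

  ChainCycle : ∀ {N} → (CVert → Fin N) → Graph N
  ChainCycle π u v =
    Σ CVert λ x → Σ CVert λ y → π x ≡ u × π y ≡ v × DisjAdj x y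

-- The distance in the chain 𝒞 has a closed form: inside a cycle it is the cyclic distance
-- of the positions, and between different cycles it is the difference of the depths
-- (distances from v¹₁), because every path from one cycle to another runs through the
-- identified vertices, the poles. With h_i = n_i / 2, the h_i - 1 antipodal pairs
-- v_{s+2}, v_{s+2+h_i} of cycle i, none of which is identified with anything, are mutually
-- maximally distant, and so are v¹₁ and the last pole v^m_{h_m+1}. These 1 + Σ (n_i - 2)/2
-- pairs are disjoint edges of 𝒞_SR, so every vertex cover is at least that large. Their
-- first ends already cover: every other vertex is a pole or lies in the far half of its
-- cycle, and of two such vertices one always has a neighbour farther from the other.

module Submission where

open import Defs
open import Data.Nat using (ℕ; zero; suc; _+_; _*_; _∸_; _≤_; _<_; z≤n; s≤s; _⊓_; _⊔_; ∣_-_∣; _≟_; _≤?_; _<?_)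
open import Data.Nat.Properties
open import Data.Nat.DivMod using (_/_; m*n/n≡m; m/n*n≡m)
open import Data.Nat.Divisibility using (_∣_)
open import Data.Nat.ListAction using (sum)
open import Data.Fin as F using (Fin; toℕ; fromℕ<)
import Data.Fin.Properties as FP
open import Data.Fin.Subset using (Subset; _∈_; ∣_∣; inside; outside)
open import Data.Vec as Vec using (_∷_; here; there)
import Data.Vec.Properties as VecP
open import Data.List using (tabulate)
open import Data.Product using (Σ; _×_; ∃; _,_; proj₁; proj₂)
open import Data.Product.Properties using (≡-dec)
open import Data.Sum using (_⊎_; inj₁; inj₂; swap; [_,_]′)
open import Data.Sum.Function.Propositional using (_⊎-↔_)
open import Data.Empty using (⊥; ⊥-elim)
open import Function using (_∘_; _↔_; mk↔ₛ′; Inverse)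
open import Function.Definitions using (Injective)
open import Function.Properties.Inverse using (↔-refl)
open import Function.Construct.Composition using (_↔-∘_)
open import Relation.Nullary using (¬_; Dec; yes; no; does)
open import Relation.Nullary.Decidable using (dec-true)
open import Relation.Binary using (tri<; tri≈; tri>)
open import Relation.Binary.PropositionalEquality

-- Walks and distances in graphs

module _ {N : ℕ} {A : Graph N} where

  infixr 5 _++ʷ_

  _++ʷ_ : ∀ {u v w a b} → Walk A u v a → Walk A v w b → Walk A u w (a + b)
  here     ++ʷ q = q
  step e p ++ʷ q = step e (p ++ʷ q)

  reverseʷ : (∀ {u v} → A u v → A v u) → ∀ {u v a} → Walk A u v a → Walk A v u a
  reverseʷ sym-A here = here
  reverseʷ sym-A (step {k = a} e p) =
    subst (Walk A _ _) (+-comm a 1) (reverseʷ sym-A p ++ʷ step (sym-A e) here)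

  shorterWalk : ∀ {u v a b} → Walk A u v a → Walk A u v b → Walk A u v (a ⊓ b)
  shorterWalk {a = a} {b} p q with ⊓-sel a b
  ... | inj₁ eq = subst (Walk A _ _) (sym eq) p
  ... | inj₂ eq = subst (Walk A _ _) (sym eq) q

  potential≤walk : (φ : Fin N → ℕ) → (∀ {u w} → A u w → φ w ≤ suc (φ u))
                 → ∀ {u v a} → Walk A u v a → φ v ≤ a + φ u
  potential≤walk φ φ-step here = ≤-refl
  potential≤walk φ φ-step (step {u} {k = a} e p) = begin
    φ _          ≤⟨ potential≤walk φ φ-step p ⟩
    a + φ _      ≤⟨ +-monoʳ-≤ a (φ-step e) ⟩
    a + suc (φ u) ≡⟨ +-suc a (φ u) ⟩
    suc a + φ u  ∎
    where open ≤-Reasoning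

  Dist-unique : ∀ {u v a b} → Dist A u v a → Dist A u v b → a ≡ b
  Dist-unique (p , p-min) (q , q-min) = ≤-antisym (p-min _ q) (q-min _ p)

  farther-neighbour⇒¬MaxDistantFrom : ∀ {u v w b} → A u w → Dist A v w (suc b) → Dist A u v b
                                   → ¬ MaxDistantFrom A u v
  farther-neighbour⇒¬MaxDistantFrom e d-vw d-uv md = n≮n _ (md _ e _ _ d-vw d-uv)

module _ {X : Set} {R : X → X → Set} where

  EqClosure-resp : ∀ {B : Set} (f : X → B) → (∀ {x y} → R x y → f x ≡ f y)
                 → ∀ {x y} → EqClosure R x y → f x ≡ f y
  EqClosure-resp f f-resp (base r)       = f-resp r
  EqClosure-resp f f-resp refl′          = refl
  EqClosure-resp f f-resp (sym′ p)       = sym (EqClosure-resp f f-resp p)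
  EqClosure-resp f f-resp (trans′ p q)   = trans (EqClosure-resp f f-resp p) (EqClosure-resp f f-resp q)

  Isolated : X → Set
  Isolated x = (∀ y → ¬ R x y) × (∀ y → ¬ R y x)

  EqClosure-isolated : ∀ {x} → Isolated x → ∀ {y z} → EqClosure R y z → (y ≡ x ⊎ z ≡ x) → y ≡ z
  EqClosure-isolated (¬Rx- , ¬R-x) (base {y} {z} r) (inj₁ refl) = ⊥-elim (¬Rx- z r)
  EqClosure-isolated (¬Rx- , ¬R-x) (base {y} {z} r) (inj₂ refl) = ⊥-elim (¬R-x y r)
  EqClosure-isolated iso refl′ _ = refl
  EqClosure-isolated iso (sym′ p) y≡x⊎z≡x = sym (EqClosure-isolated iso p (swap y≡x⊎z≡x))
  EqClosure-isolated iso (trans′ p q) (inj₁ y≡x) =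
    let p-eq = EqClosure-isolated iso p (inj₁ y≡x) in
    trans p-eq (EqClosure-isolated iso q (inj₁ (trans (sym p-eq) y≡x)))
  EqClosure-isolated iso (trans′ p q) (inj₂ z≡x) =
    let q-eq = EqClosure-isolated iso q (inj₂ z≡x) in
    trans (EqClosure-isolated iso p (inj₂ (trans q-eq z≡x))) q-eq

-- Counting in finite subsets, and vertex covers from matchings

rank : ∀ {N} (S : Subset N) (x : Fin N) → x ∈ S → Fin ∣ S ∣
rank (inside  ∷ S) F.zero    here      = F.zero
rank (inside  ∷ S) (F.suc x) (there p) = F.suc (rank S x p)
rank (outside ∷ S) (F.suc x) (there p) = rank S x p

rank-injective : ∀ {N} (S : Subset N) {x y : Fin N} (p : x ∈ S) (q : y ∈ S) → rank S x p ≡ rank S y q → x ≡ y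
rank-injective (inside  ∷ S) here      here      eq = refl
rank-injective (inside  ∷ S) (there p) (there q) eq = cong F.suc (rank-injective S p q (FP.suc-injective eq))
rank-injective (outside ∷ S) (there p) (there q) eq = cong F.suc (rank-injective S p q eq)

unrank : ∀ {N} (S : Subset N) → Fin ∣ S ∣ → Fin N
unrank (inside  ∷ S) F.zero    = F.zero
unrank (inside  ∷ S) (F.suc r) = F.suc (unrank S r)
unrank (outside ∷ S) r         = F.suc (unrank S r)

unrank-injective : ∀ {N} (S : Subset N) → Injective _≡_ _≡_ (unrank S)
unrank-injective (inside  ∷ S) {F.zero}  {F.zero}  eq = refl
unrank-injective (inside  ∷ S) {F.suc r} {F.suc s} eq = cong F.suc (unrank-injective S (FP.suc-injective eq))
unrank-injective (outside ∷ S)                     eq = unrank-injective S (FP.suc-injective eq)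

unrank∈ : ∀ {N} (S : Subset N) (r : Fin ∣ S ∣) → unrank S r ∈ S
unrank∈ (inside  ∷ S) F.zero    = here
unrank∈ (inside  ∷ S) (F.suc r) = there (unrank∈ S r)
unrank∈ (outside ∷ S) r         = there (unrank∈ S r)

injective⇒≤∣_∣ : ∀ {N c} (S : Subset N) {f : Fin c → Fin N} → Injective _≡_ _≡_ f → (∀ t → f t ∈ S)
              → c ≤ ∣ S ∣
injective⇒≤∣ S ∣ f-inj f∈S =
  FP.injective⇒≤ (λ eq → f-inj (rank-injective S (f∈S _) (f∈S _) eq))

Σ-Fin-suc↔ : ∀ {m} {B : Fin (suc m) → Set} → (B F.zero ⊎ Σ (Fin m) (B ∘ F.suc)) ↔ Σ (Fin (suc m)) B
Σ-Fin-suc↔ {B = B} = mk↔ₛ′ to from to∘from from∘to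
  where
  to : B F.zero ⊎ Σ _ (B ∘ F.suc) → Σ _ B
  to (inj₁ b)       = F.zero , b
  to (inj₂ (i , b)) = F.suc i , b
  from : Σ _ B → B F.zero ⊎ Σ _ (B ∘ F.suc)
  from (F.zero  , b) = inj₁ b
  from (F.suc i , b) = inj₂ (i , b)
  to∘from : ∀ p → to (from p) ≡ p
  to∘from (F.zero  , b) = refl
  to∘from (F.suc i , b) = refl
  from∘to : ∀ p → from (to p) ≡ p
  from∘to (inj₁ b) = refl
  from∘to (inj₂ p) = refl

sum↔Σ : ∀ {m} (g : Fin m → ℕ) → Fin (sum (tabulate g)) ↔ Σ (Fin m) (Fin ∘ g)
sum↔Σ {zero}  g = mk↔ₛ′ (λ ()) (λ { (() , _) }) (λ { (() , _) }) (λ ())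
sum↔Σ {suc m} g = Σ-Fin-suc↔ ↔-∘ ((↔-refl ⊎-↔ sum↔Σ (g ∘ F.suc)) ↔-∘ FP.+↔⊎)

module _ {N : ℕ} where

  image : ∀ {c} → (Fin c → Fin N) → Subset N
  image f = Vec.tabulate (λ u → does (FP.any? (λ t → f t FP.≟ u)))

  module _ {c : ℕ} (f : Fin c → Fin N) where

    ∈image : ∀ t → f t ∈ image f
    ∈image t = VecP.lookup⇒[]= (f t) (image f)
      (trans (VecP.lookup∘tabulate _ (f t)) (dec-true (FP.any? (λ t′ → f t′ FP.≟ f t)) (t , refl)))

    ∈image⁻ : ∀ {u} → u ∈ image f → ∃ λ t → f t ≡ u
    -- The second abstraction refutes the no branch: it reads false ≡ true there.
    ∈image⁻ {u} u∈ with FP.any? (λ t → f t FP.≟ u)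
                       | trans (sym (VecP.lookup∘tabulate _ u)) (VecP.[]=⇒lookup u∈)
    ... | yes p | _ = p

    ∈image? : ∀ u → u ∈ image f ⊎ (∀ t → f t ≢ u)
    ∈image? u with FP.any? (λ t → f t FP.≟ u)
    ... | yes (t , refl) = inj₁ (∈image t)
    ... | no ∄t          = inj₂ (λ t eq → ∄t (t , eq))

    ∣image∣≡ : Injective _≡_ _≡_ f → ∣ image f ∣ ≡ c
    ∣image∣≡ f-inj = ≤-antisym ∣image∣≤c (injective⇒≤∣ image f ∣ f-inj ∈image)
      where
      preimage : Fin ∣ image f ∣ → Fin c
      preimage r = proj₁ (∈image⁻ (unrank∈ (image f) r))

      ∣image∣≤c : ∣ image f ∣ ≤ c
      ∣image∣≤c = FP.injective⇒≤ {f = preimage} λ {r} {s} eq → unrank-injective (image f)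
        (trans (sym (proj₂ (∈image⁻ (unrank∈ (image f) r))))
          (trans (cong f eq) (proj₂ (∈image⁻ (unrank∈ (image f) s)))))

matching⇒VertexCoverNumber : ∀ {N c} (H : Graph N) (f g : Fin c → Fin N)
  → (∀ t → H (f t) (g t)) → Injective _≡_ _≡_ f → Injective _≡_ _≡_ g → (∀ t t′ → f t ≢ g t′)
  → (∀ {u v} → H u v → (∀ t → f t ≢ u) → (∀ t → f t ≢ v) → ⊥)
  → VertexCoverNumber H c
matching⇒VertexCoverNumber {c = c} H f g matched f-inj g-inj f≢g f-covers =
  (image f , image-covers , ∣image∣≡ f f-inj) , cover≥c
  where
  image-covers : IsVertexCover H (image f)
  image-covers u v e with ∈image? f u | ∈image? f v
  ... | inj₁ u∈ | _       = inj₁ u∈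
  ... | inj₂ _  | inj₁ v∈ = inj₂ v∈
  ... | inj₂ u∉ | inj₂ v∉ = ⊥-elim (f-covers e u∉ v∉)

  cover≥c : ∀ S → IsVertexCover H S → c ≤ ∣ S ∣
  cover≥c S cover = injective⇒≤∣ S ∣ chosen-inj chosen∈S
    where
    end : ∀ t → f t ∈ S ⊎ g t ∈ S → Fin _
    end t (inj₁ _) = f t
    end t (inj₂ _) = g t

    end∈S : ∀ t (p : f t ∈ S ⊎ g t ∈ S) → end t p ∈ S
    end∈S t (inj₁ f∈) = f∈
    end∈S t (inj₂ g∈) = g∈

    end-injective : ∀ {t t′} p q → end t p ≡ end t′ q → t ≡ t′
    end-injective (inj₁ _) (inj₁ _) eq = f-inj eq
    end-injective (inj₁ _) (inj₂ _) eq = ⊥-elim (f≢g _ _ eq)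
    end-injective (inj₂ _) (inj₁ _) eq = ⊥-elim (f≢g _ _ (sym eq))
    end-injective (inj₂ _) (inj₂ _) eq = g-inj eq

    chosen : Fin _ → Fin _
    chosen t = end t (cover _ _ (matched t))

    chosen-inj : Injective _≡_ _≡_ chosen
    chosen-inj {t} {t′} = end-injective (cover _ _ (matched t)) (cover _ _ (matched t′))

    chosen∈S : ∀ t → chosen t ∈ S
    chosen∈S t = end∈S t (cover _ _ (matched t))

-- Distances on a cycle

infix 4 _≈₁_

_≈₁_ : ℕ → ℕ → Set
x ≈₁ y = x ≤ suc y × y ≤ suc x

≈₁-sym : ∀ {x y} → x ≈₁ y → y ≈₁ x
≈₁-sym (x≤1+y , y≤1+x) = y≤1+x , x≤1+y

≈₁⇒∣-∣≤1 : ∀ {x y} → x ≈₁ y → ∣ x - y ∣ ≤ 1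
≈₁⇒∣-∣≤1 {x} {y} (x≤1+y , y≤1+x) with ∣m-n∣≡[m∸n]∨[n∸m] x y
... | inj₁ eq = subst (_≤ 1) (sym eq) (subst (x ∸ y ≤_) (m+n∸n≡m 1 y) (∸-monoˡ-≤ y x≤1+y))
... | inj₂ eq = subst (_≤ 1) (sym eq) (subst (y ∸ x ≤_) (m+n∸n≡m 1 x) (∸-monoˡ-≤ x y≤1+x))

∣-∣-≈₁ : ∀ p {y y′} → y ≈₁ y′ → ∣ p - y ∣ ≈₁ ∣ p - y′ ∣
∣-∣-≈₁ p {y} {y′} y≈y′ = shift (≈₁-sym y≈y′) , shift y≈y′
  where
  shift : ∀ {u v} → u ≈₁ v → ∣ p - v ∣ ≤ suc ∣ p - u ∣
  shift {u} {v} u≈v = ≤-trans (∣-∣-triangle p u v)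
    (≤-trans (+-monoʳ-≤ ∣ p - u ∣ (≈₁⇒∣-∣≤1 u≈v)) (≤-reflexive (+-comm ∣ p - u ∣ 1)))

+-≈₁ : ∀ o {y y′} → y ≈₁ y′ → o + y ≈₁ o + y′
+-≈₁ o {y} {y′} (y≤1+y′ , y′≤1+y) =
  ≤-trans (+-monoʳ-≤ o y≤1+y′) (≤-reflexive (+-suc o y′)) ,
  ≤-trans (+-monoʳ-≤ o y′≤1+y) (≤-reflexive (+-suc o y))

∣-∣≤ : ∀ {x y c} → x ≤ c → y ≤ c → ∣ x - y ∣ ≤ c
∣-∣≤ {x} {y} x≤c y≤c = ≤-trans (∣m-n∣≤m⊔n x y) (⊔-lub x≤c y≤c)

∣suc-∣ : ∀ x b → ∣ suc x - b ∣ ≡ suc ∣ x - b ∣ ⊎ ∣ x - b ∣ ≡ suc ∣ suc x - b ∣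
∣suc-∣ zero    zero    = inj₁ refl
∣suc-∣ (suc x) zero    = inj₁ refl
∣suc-∣ zero    (suc b) = inj₂ refl
∣suc-∣ (suc x) (suc b) = ∣suc-∣ x b

m∸n≡1+[m∸1+n] : ∀ {m n} → n < m → m ∸ n ≡ suc (m ∸ suc n)
m∸n≡1+[m∸1+n] n<m = +-∸-assoc 1 n<m

m∸[n∸o]≡m∸n+o : ∀ {m n o} → o ≤ n → n ≤ m → m ∸ (n ∸ o) ≡ (m ∸ n) + o
m∸[n∸o]≡m∸n+o {m} {n} {o} o≤n n≤m = begin
  m ∸ (n ∸ o)                         ≡⟨ cong (_∸ (n ∸ o)) (sym m∸n+o+[n∸o]≡m) ⟩
  ((m ∸ n) + o) + (n ∸ o) ∸ (n ∸ o)   ≡⟨ m+n∸n≡m ((m ∸ n) + o) (n ∸ o) ⟩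
  (m ∸ n) + o                         ∎
  where
  open ≡-Reasoning
  m∸n+o+[n∸o]≡m : ((m ∸ n) + o) + (n ∸ o) ≡ m
  m∸n+o+[n∸o]≡m = trans (+-assoc (m ∸ n) o (n ∸ o)) (trans (cong ((m ∸ n) +_) (m+[n∸m]≡n o≤n)) (m∸n+n≡m n≤m))

[n∸m]+[o∸[p+n]]≡o∸[p+m] : ∀ {m n o p} → m ≤ n → p + n ≤ o → (n ∸ m) + (o ∸ (p + n)) ≡ o ∸ (p + m)
[n∸m]+[o∸[p+n]]≡o∸[p+m] {m} {n} {o} {p} m≤n p+n≤o = begin
  (n ∸ m) + (o ∸ (p + n))              ≡⟨ +-comm (n ∸ m) _ ⟩
  (o ∸ (p + n)) + (n ∸ m)              ≡⟨ cong ((o ∸ (p + n)) +_) (sym ([m+n]∸[m+o]≡n∸o p n m)) ⟩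
  (o ∸ (p + n)) + ((p + n) ∸ (p + m))  ≡⟨ sym (+-∸-assoc (o ∸ (p + n)) (+-monoʳ-≤ p m≤n)) ⟩
  ((o ∸ (p + n)) + (p + n)) ∸ (p + m)  ≡⟨ cong (_∸ (p + m)) (m∸n+n≡m p+n≤o) ⟩
  o ∸ (p + m)                          ∎
  where open ≡-Reasoning

cycDist : ℕ → ℕ → ℕ
cycDist c e = e ⊓ (c ∸ e)

-- CycSucc ignores its chain argument: this is the successor relation of the cycle on Fin c.
CycleSucc : (c : ℕ) → Fin c → Fin c → Set
CycleSucc c = CycSucc {0} (λ _ → c) c

CycleAdj : (c : ℕ) → Fin c → Fin c → Set
CycleAdj c a a′ = CycleSucc c a a′ ⊎ CycleSucc c a′ a

next : ∀ {c} (a : Fin c) → Σ (Fin c) (CycleSucc c a)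
next {suc c} a with suc (toℕ a) <? suc c
... | yes 1+a<c = fromℕ< 1+a<c , inj₁ (FP.toℕ-fromℕ< 1+a<c)
... | no  1+a≮c = F.zero , inj₂ (≤-antisym (FP.toℕ<n a) (≮⇒≥ 1+a≮c) , refl)

prev : ∀ {c} (a : Fin c) → Σ (Fin c) (λ a′ → CycleSucc c a′ a)
prev {suc c} F.zero    = F.fromℕ c , inj₂ (cong suc (FP.toℕ-fromℕ c) , refl)
prev {suc c} (F.suc a) = F.inject₁ a , inj₁ (cong suc (sym (FP.toℕ-inject₁ a)))

firstFin lastFin : ∀ {c} → Fin c → Fin c
firstFin {suc c} _ = F.zero
lastFin  {suc c} _ = F.fromℕ c

toℕ-firstFin : ∀ {c} (a : Fin c) → toℕ (firstFin a) ≡ 0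
toℕ-firstFin {suc c} _ = refl

suc-toℕ-lastFin : ∀ {c} (a : Fin c) → suc (toℕ (lastFin a)) ≡ c
suc-toℕ-lastFin {suc c} _ = cong suc (FP.toℕ-fromℕ c)

cycDist-reflect : ∀ {c e} → e ≤ c → cycDist c (c ∸ e) ≡ cycDist c e
cycDist-reflect {c} {e} e≤c rewrite m∸[m∸n]≡n e≤c = ⊓-comm (c ∸ e) e

cycDist-suc≈₁ : ∀ {c e} → suc e ≤ c → cycDist c e ≈₁ cycDist c (suc e)
cycDist-suc≈₁ {c} {e} 1+e≤c =
  ⊓-mono-≤ (≤-trans (n≤1+n e) (n≤1+n (suc e))) (≤-reflexive (+-∸-assoc 1 1+e≤c)) ,
  ⊓-mono-≤ (≤-refl {suc e}) (≤-trans (∸-monoʳ-≤ c (n≤1+n e)) (n≤1+n (c ∸ e)))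

cycDist-∣suc-∣≈₁ : ∀ {c} x b → suc x ≤ c → b ≤ c → cycDist c ∣ x - b ∣ ≈₁ cycDist c ∣ suc x - b ∣
cycDist-∣suc-∣≈₁ x b 1+x≤c b≤c with ∣suc-∣ x b
... | inj₁ eq rewrite eq = cycDist-suc≈₁ (subst (_≤ _) eq (∣-∣≤ 1+x≤c b≤c))
... | inj₂ eq rewrite eq = ≈₁-sym (cycDist-suc≈₁ (subst (_≤ _) eq (∣-∣≤ (<⇒≤ 1+x≤c) b≤c)))

-- The wrap-around edge (c - 1, 0) behaves like the edge (c - 1, c).
cycDist-CycleSucc : ∀ {c} {a a′ : Fin c} b → b ≤ c → CycleSucc c a a′
                  → cycDist c ∣ toℕ a′ - b ∣ ≡ cycDist c ∣ suc (toℕ a) - b ∣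
cycDist-CycleSucc b b≤c (inj₁ a′≡1+a) = cong (λ x → cycDist _ ∣ x - b ∣) a′≡1+a
cycDist-CycleSucc b b≤c (inj₂ (1+a≡c , a′≡0))
  rewrite a′≡0 | 1+a≡c | m≤n⇒∣n-m∣≡n∸m b≤c = sym (cycDist-reflect b≤c)

cycDist-CycleSucc≈₁ : ∀ {c} {a a′ : Fin c} b → b ≤ c → CycleSucc c a a′
                    → cycDist c ∣ toℕ a - b ∣ ≈₁ cycDist c ∣ toℕ a′ - b ∣
cycDist-CycleSucc≈₁ {a = a} b b≤c a→a′ =
  subst (_ ≈₁_) (sym (cycDist-CycleSucc b b≤c a→a′)) (cycDist-∣suc-∣≈₁ (toℕ a) b (FP.toℕ<n a) b≤c)

cycleAdj≈₁ : ∀ {c} {a a′ : Fin c} b → b ≤ c → CycleAdj c a a′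
           → cycDist c ∣ toℕ a - b ∣ ≈₁ cycDist c ∣ toℕ a′ - b ∣
cycleAdj≈₁ b b≤c (inj₁ a→a′) = cycDist-CycleSucc≈₁ b b≤c a→a′
cycleAdj≈₁ b b≤c (inj₂ a′→a) = ≈₁-sym (cycDist-CycleSucc≈₁ b b≤c a′→a)

module _ {N : ℕ} {A : Graph N} (A-sym : ∀ {u v} → A u v → A v u)
         {c : ℕ} (ι : Fin c → Fin N) (ι-edge : ∀ {a a′} → CycleSucc c a a′ → A (ι a) (ι a′)) where

  forwardWalk : ∀ d (a b : Fin c) → toℕ b ≡ toℕ a + d → Walk A (ι a) (ι b) d
  forwardWalk zero    a b b≡a+0 = subst (λ x → Walk A (ι a) (ι x) 0)
    (FP.toℕ-injective (trans (sym (+-identityʳ _)) (sym b≡a+0))) here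
  forwardWalk (suc d) a b b≡a+1+d = step (ι-edge (inj₁ (FP.toℕ-fromℕ< 1+a<c))) (forwardWalk d (fromℕ< 1+a<c) b b≡a′+d)
    where
    1+a<c : suc (toℕ a) < c
    1+a<c = ≤-<-trans (s≤s (m≤m+n (toℕ a) d)) (subst (_< c) (trans b≡a+1+d (+-suc (toℕ a) d)) (FP.toℕ<n b))
    b≡a′+d : toℕ b ≡ toℕ (fromℕ< 1+a<c) + d
    b≡a′+d = trans b≡a+1+d (trans (+-suc (toℕ a) d) (cong (_+ d) (sym (FP.toℕ-fromℕ< 1+a<c))))

  wrapWalk : (a b : Fin c) → toℕ a ≤ toℕ b → Walk A (ι b) (ι a) (c ∸ (toℕ b ∸ toℕ a))
  wrapWalk a b a≤b = subst (Walk A (ι b) (ι a)) length-eq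
    (forwardWalk (toℕ ℓ ∸ toℕ b) b ℓ (sym (m+[n∸m]≡n b≤ℓ))
      ++ʷ step (ι-edge (inj₂ (suc-toℕ-lastFin a , toℕ-firstFin a)))
               (forwardWalk (toℕ a) (firstFin a) a (cong (_+ toℕ a) (sym (toℕ-firstFin a)))))
    where
    ℓ : Fin c
    ℓ = lastFin a
    b≤ℓ : toℕ b ≤ toℕ ℓ
    b≤ℓ = ≤-pred (subst (toℕ b <_) (sym (suc-toℕ-lastFin a)) (FP.toℕ<n b))
    length-eq : (toℕ ℓ ∸ toℕ b) + suc (toℕ a) ≡ c ∸ (toℕ b ∸ toℕ a)
    length-eq = begin
      (toℕ ℓ ∸ toℕ b) + suc (toℕ a)   ≡⟨ +-suc (toℕ ℓ ∸ toℕ b) (toℕ a) ⟩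
      suc ((toℕ ℓ ∸ toℕ b) + toℕ a)   ≡⟨ cong suc (sym (m∸[n∸o]≡m∸n+o a≤b b≤ℓ)) ⟩
      suc (toℕ ℓ ∸ (toℕ b ∸ toℕ a))   ≡⟨ sym (+-∸-assoc 1 (≤-trans (m∸n≤m (toℕ b) (toℕ a)) b≤ℓ)) ⟩
      suc (toℕ ℓ) ∸ (toℕ b ∸ toℕ a)   ≡⟨ cong (_∸ (toℕ b ∸ toℕ a)) (suc-toℕ-lastFin a) ⟩
      c ∸ (toℕ b ∸ toℕ a)             ∎
      where open ≡-Reasoning

  cycleWalk : (a b : Fin c) → Walk A (ι a) (ι b) (cycDist c ∣ toℕ a - toℕ b ∣)
  cycleWalk a b with ≤-total (toℕ a) (toℕ b)
  ... | inj₁ a≤b rewrite m≤n⇒∣m-n∣≡n∸m a≤b =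
    shorterWalk (forwardWalk _ a b (sym (m+[n∸m]≡n a≤b))) (reverseʷ A-sym (wrapWalk a b a≤b))
  ... | inj₂ b≤a rewrite m≤n⇒∣n-m∣≡n∸m b≤a =
    shorterWalk (reverseʷ A-sym (forwardWalk _ b a (sym (m+[n∸m]≡n b≤a)))) (wrapWalk b a b≤a)

cycDist-CycleSucc₀ : ∀ {c} {a a′ : Fin c} → CycleSucc c a a′ → cycDist c (toℕ a′) ≡ cycDist c (suc (toℕ a))
cycDist-CycleSucc₀ {c} a→a′ = subst₂ (λ x y → cycDist c x ≡ cycDist c y) (∣-∣-identityʳ _) (∣-∣-identityʳ _)
  (cycDist-CycleSucc 0 z≤n a→a′)

Farther : ∀ {c} → Fin c → ℕ → Set
Farther {c} a b = ∃ λ a′ → CycleAdj c a a′ × cycDist c ∣ toℕ a′ - b ∣ ≡ suc (cycDist c ∣ toℕ a - b ∣)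

farther-via-succ : ∀ {c} {a a′ : Fin c} b → b ≤ c → CycleSucc c a a′
                 → cycDist c ∣ suc (toℕ a) - b ∣ ≡ suc (cycDist c ∣ toℕ a - b ∣) → Farther a b
farther-via-succ b b≤c a→a′ eq = _ , inj₁ a→a′ , trans (cycDist-CycleSucc b b≤c a→a′) eq

farther-via-pred : ∀ {c} {a a′ : Fin c} b → b ≤ c → CycleSucc c a′ a
                 → cycDist c ∣ toℕ a′ - b ∣ ≡ suc (cycDist c ∣ suc (toℕ a′) - b ∣) → Farther a b
farther-via-pred b b≤c a′→a eq = _ , inj₂ a′→a , trans eq (cong suc (sym (cycDist-CycleSucc b b≤c a′→a)))

module EvenCycle {c h : ℕ} (c≡h+h : c ≡ h + h) where

  c∸h≡h : c ∸ h ≡ h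
  c∸h≡h = trans (cong (_∸ h) c≡h+h) (m+n∸n≡m h h)

  cycDist-lo : ∀ {e} → e ≤ h → cycDist c e ≡ e
  cycDist-lo {e} e≤h = m≤n⇒m⊓n≡m (≤-trans e≤h (subst (_≤ c ∸ e) c∸h≡h (∸-monoʳ-≤ c e≤h)))

  cycDist-hi : ∀ {e} → h ≤ e → cycDist c e ≡ c ∸ e
  cycDist-hi {e} h≤e = m≥n⇒m⊓n≡n (≤-trans (subst (c ∸ e ≤_) c∸h≡h (∸-monoʳ-≤ c h≤e)) h≤e)

  cycDist≤h : ∀ e → cycDist c e ≤ h
  cycDist≤h e with ≤-total e h
  ... | inj₁ e≤h = ≤-trans (m⊓n≤m e (c ∸ e)) e≤h
  ... | inj₂ h≤e = ≤-trans (m⊓n≤n e (c ∸ e)) (subst (c ∸ e ≤_) c∸h≡h (∸-monoʳ-≤ c h≤e))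

  cycDist-h : cycDist c h ≡ h
  cycDist-h = cycDist-lo ≤-refl

  cycDist-suc-near : ∀ {e} → suc e ≤ h → cycDist c (suc e) ≡ suc (cycDist c e)
  cycDist-suc-near 1+e≤h = trans (cycDist-lo 1+e≤h) (cong suc (sym (cycDist-lo (<⇒≤ 1+e≤h))))

  cycDist-suc-far : ∀ {e} → h ≤ e → suc e ≤ c → cycDist c e ≡ suc (cycDist c (suc e))
  cycDist-suc-far h≤e 1+e≤c =
    trans (cycDist-hi h≤e) (trans (+-∸-assoc 1 1+e≤c) (cong suc (sym (cycDist-hi (m≤n⇒m≤1+n h≤e)))))

  cycDist-antipode : ∀ {a} → a < c → cycDist c ∣ a - h ∣ ≡ h ∸ cycDist c a
  cycDist-antipode {a} a<c with ≤-total a h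
  ... | inj₁ a≤h rewrite m≤n⇒∣m-n∣≡n∸m a≤h | cycDist-lo (m∸n≤m h a) | cycDist-lo a≤h = refl
  ... | inj₂ h≤a = begin
    cycDist c ∣ a - h ∣  ≡⟨ cong (cycDist c) (m≤n⇒∣n-m∣≡n∸m h≤a) ⟩
    cycDist c t          ≡⟨ cycDist-lo t≤h ⟩
    t                    ≡⟨ sym (m∸[m∸n]≡n t≤h) ⟩
    h ∸ (h ∸ t)          ≡⟨ cong (h ∸_) (sym c∸a≡h∸t) ⟩
    h ∸ (c ∸ a)          ≡⟨ cong (h ∸_) (sym (cycDist-hi h≤a)) ⟩
    h ∸ cycDist c a      ∎
    where
    open ≡-Reasoning
    t = a ∸ h
    t≤h : t ≤ h
    t≤h = <⇒≤ (subst (t <_) c∸h≡h (∸-monoˡ-< a<c h≤a))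
    c∸a≡h∸t : c ∸ a ≡ h ∸ t
    c∸a≡h∸t = begin
      c ∸ a                ≡⟨ cong₂ _∸_ c≡h+h (sym (m+[n∸m]≡n h≤a)) ⟩
      (h + h) ∸ (h + t)    ≡⟨ [m+n]∸[m+o]≡n∸o h h t ⟩
      h ∸ t                ∎

  -- x ↦ cycDist c ∣ x - b ∣ is a tent: it rises from b up to the antipode of b, then falls.
  tent-up : ∀ {x b} → b ≤ x → suc (x ∸ b) ≤ h → cycDist c ∣ suc x - b ∣ ≡ suc (cycDist c ∣ x - b ∣)
  tent-up {x} {b} b≤x 1+e≤h
    rewrite m≤n⇒∣n-m∣≡n∸m b≤x | m≤n⇒∣n-m∣≡n∸m (m≤n⇒m≤1+n b≤x) | +-∸-assoc 1 b≤x = cycDist-suc-near 1+e≤h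

  tent-down : ∀ {x b} → b ≤ x → h ≤ x ∸ b → suc x ≤ c → cycDist c ∣ x - b ∣ ≡ suc (cycDist c ∣ suc x - b ∣)
  tent-down {x} {b} b≤x h≤e 1+x≤c
    rewrite m≤n⇒∣n-m∣≡n∸m b≤x | m≤n⇒∣n-m∣≡n∸m (m≤n⇒m≤1+n b≤x) | +-∸-assoc 1 b≤x =
    cycDist-suc-far h≤e (≤-trans (s≤s (m∸n≤m x b)) 1+x≤c)

  tent-up′ : ∀ {x b} → x < b → h ≤ b ∸ suc x → b ≤ c → cycDist c ∣ suc x - b ∣ ≡ suc (cycDist c ∣ x - b ∣)
  tent-up′ {x} {b} x<b h≤e b≤c
    rewrite m≤n⇒∣m-n∣≡n∸m x<b | m≤n⇒∣m-n∣≡n∸m (<⇒≤ x<b) | m∸n≡1+[m∸1+n] x<b =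
    cycDist-suc-far h≤e (≤-trans (≤-reflexive (sym (m∸n≡1+[m∸1+n] x<b))) (≤-trans (m∸n≤m b x) b≤c))

  tent-down′ : ∀ {x b} → x < b → suc (b ∸ suc x) ≤ h → cycDist c ∣ x - b ∣ ≡ suc (cycDist c ∣ suc x - b ∣)
  tent-down′ {x} {b} x<b 1+e≤h
    rewrite m≤n⇒∣m-n∣≡n∸m x<b | m≤n⇒∣m-n∣≡n∸m (<⇒≤ x<b) | m∸n≡1+[m∸1+n] x<b = cycDist-suc-near 1+e≤h

  cycDist≢h : ∀ {e} → cycDist c e < h → e ≢ h
  cycDist≢h δ<h refl = <-irrefl cycDist-h δ<h

  cycle-farther-≤ : (a : Fin c) (b : ℕ) → b < c → cycDist c ∣ toℕ a - b ∣ < h → b ≤ toℕ a → Farther a b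
  cycle-farther-≤ a b b<c δ<h b≤a with <-cmp (toℕ a ∸ b) h
  ... | tri< e<h _ _ = farther-via-succ b (<⇒≤ b<c) (proj₂ (next a)) (tent-up b≤a e<h)
  ... | tri≈ _ e≡h _ = ⊥-elim (cycDist≢h δ<h (trans (m≤n⇒∣n-m∣≡n∸m b≤a) e≡h))
  ... | tri> _ _ h<e with prev a
  ...   | a′ , inj₂ (_ , a≡0) = ⊥-elim (<⇒≱ h<e (≤-trans (m∸n≤m (toℕ a) b) (≤-trans (≤-reflexive a≡0) z≤n)))
  ...   | a′ , inj₁ a≡1+a′ =
    farther-via-pred b (<⇒≤ b<c) (inj₁ a≡1+a′) (tent-down b≤a′ h≤e′ (subst (_≤ c) a≡1+a′ (<⇒≤ (FP.toℕ<n a))))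
    where
    b<a : b < toℕ a
    b<a = m∸n≢0⇒n<m (λ e≡0 → <⇒≱ h<e (≤-trans (≤-reflexive e≡0) z≤n))
    b≤a′ : b ≤ toℕ a′
    b≤a′ = ≤-pred (subst (b <_) a≡1+a′ b<a)
    h≤e′ : h ≤ toℕ a′ ∸ b
    h≤e′ = ≤-pred (subst (h <_) (trans (cong (_∸ b) a≡1+a′) (+-∸-assoc 1 b≤a′)) h<e)

  cycle-farther-≥ : (a : Fin c) (b : ℕ) → b < c → cycDist c ∣ toℕ a - b ∣ < h → toℕ a ≤ b → Farther a b
  cycle-farther-≥ a b b<c δ<h a≤b with <-cmp (b ∸ toℕ a) h
  ... | tri≈ _ e≡h _ = ⊥-elim (cycDist≢h δ<h (trans (m≤n⇒∣m-n∣≡n∸m a≤b) e≡h))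
  ... | tri> _ _ h<e = farther-via-succ b (<⇒≤ b<c) (proj₂ (next a)) (tent-up′ a<b h≤e′ (<⇒≤ b<c))
    where
    a<b : toℕ a < b
    a<b = m∸n≢0⇒n<m (λ e≡0 → <⇒≱ h<e (≤-trans (≤-reflexive e≡0) z≤n))
    h≤e′ : h ≤ b ∸ suc (toℕ a)
    h≤e′ = ≤-pred (subst (h <_) (m∸n≡1+[m∸1+n] a<b) h<e)
  ... | tri< e<h _ _ with prev a
  ...   | a′ , inj₁ a≡1+a′ =
    farther-via-pred b (<⇒≤ b<c) (inj₁ a≡1+a′) (tent-down′ a′<b (subst (λ x → suc (b ∸ x) ≤ h) a≡1+a′ e<h))
    where
    a′<b : toℕ a′ < b
    a′<b = subst (_≤ b) a≡1+a′ a≤b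
  ...   | a′ , inj₂ (1+a′≡c , a≡0) =
    farther-via-pred b (<⇒≤ b<c) (inj₂ (1+a′≡c , a≡0)) (tent-down b≤a′ h≤e′ (≤-reflexive 1+a′≡c))
    where
    b≤a′ : b ≤ toℕ a′
    b≤a′ = ≤-pred (subst (b <_) (sym 1+a′≡c) b<c)
    1+b≤h : suc b ≤ h
    1+b≤h = subst (λ x → suc (b ∸ x) ≤ h) a≡0 e<h
    h≤e′ : h ≤ toℕ a′ ∸ b
    h≤e′ = subst (h ≤_) (cong (_∸ suc b) (sym 1+a′≡c)) (subst (_≤ c ∸ suc b) c∸h≡h (∸-monoʳ-≤ c 1+b≤h))

  cycle-farther : (a : Fin c) (b : ℕ) → b < c → cycDist c ∣ toℕ a - b ∣ < h → Farther a b
  cycle-farther a b b<c δ<h = [ cycle-farther-≤ a b b<c δ<h , cycle-farther-≥ a b b<c δ<h ]′ (≤-total b (toℕ a))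

  cycle-toward-0 : (a : Fin c) → 0 < toℕ a
                 → ∃ λ a′ → CycleAdj c a a′ × suc (cycDist c (toℕ a′)) ≡ cycDist c (toℕ a)
  cycle-toward-0 a 0<a with ≤-total (toℕ a) h
  ... | inj₂ h≤a = _ , inj₁ (proj₂ (next a)) ,
    trans (cong suc (cycDist-CycleSucc₀ (proj₂ (next a)))) (sym (cycDist-suc-far h≤a (FP.toℕ<n a)))
  ... | inj₁ a≤h with prev a
  ...   | a′ , inj₂ (_ , a≡0) = ⊥-elim (<⇒≢ 0<a (sym a≡0))
  ...   | a′ , inj₁ a≡1+a′ = a′ , inj₂ (inj₁ a≡1+a′) ,
    sym (trans (cong (cycDist c) a≡1+a′) (cycDist-suc-near (subst (_≤ h) a≡1+a′ a≤h)))

  cycDist-farHalf< : ∀ {a b} → h < a → a < c → b ≡ 0 ⊎ h ≤ b → b < c → cycDist c ∣ a - b ∣ < h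
  cycDist-farHalf< {a} h<a a<c (inj₁ refl) _ rewrite ∣-∣-identityʳ a | cycDist-hi (<⇒≤ h<a) =
    subst (c ∸ a <_) c∸h≡h (∸-monoʳ-< h<a (<⇒≤ a<c))
  cycDist-farHalf< {a} {b} h<a a<c (inj₂ h≤b) b<c = ≤-<-trans (m⊓n≤m _ _) (begin-strict
    ∣ a - b ∣                  ≡⟨ cong₂ ∣_-_∣ (sym (m+[n∸m]≡n (<⇒≤ h<a))) (sym (m+[n∸m]≡n h≤b)) ⟩
    ∣ h + (a ∸ h) - h + (b ∸ h) ∣ ≡⟨ ∣m+n-m+o∣≡∣n-o∣ h (a ∸ h) (b ∸ h) ⟩
    ∣ (a ∸ h) - (b ∸ h) ∣      ≤⟨ ∣m-n∣≤m⊔n (a ∸ h) (b ∸ h) ⟩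
    (a ∸ h) ⊔ (b ∸ h)          <⟨ ⊔-lub (below-h a<c (<⇒≤ h<a)) (below-h b<c h≤b) ⟩
    h                          ∎)
    where
    open ≤-Reasoning
    below-h : ∀ {x} → x < c → h ≤ x → x ∸ h < h
    below-h {x} x<c h≤x = subst (x ∸ h <_) c∸h≡h (∸-monoˡ-< x<c h≤x)

  cycle-away-from-0 : (a : Fin c) → cycDist c (toℕ a) < h
                    → ∃ λ a′ → CycleAdj c a a′ × cycDist c (toℕ a′) ≡ suc (cycDist c (toℕ a))
  cycle-away-from-0 a δa<h
    with cycle-farther a 0 (≤-<-trans z≤n (FP.toℕ<n a)) (subst (_< h) (cong (cycDist c) (sym (∣-∣-identityʳ _))) δa<h)
  ... | a′ , a∼a′ , eq =
    a′ , a∼a′ , subst₂ (λ x y → cycDist c x ≡ suc (cycDist c y)) (∣-∣-identityʳ _) (∣-∣-identityʳ _) eq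

-- The chain cycle

offsets : ∀ {k} → (Fin (suc k) → ℕ) → Fin (suc k) → ℕ
offsets         g F.zero    = 0
offsets {suc k} g (F.suc i) = g F.zero + offsets (g ∘ F.suc) i

offsets-step : ∀ {k} (g : Fin (suc k) → ℕ) {i i′ : Fin (suc k)} → toℕ i′ ≡ suc (toℕ i)
             → offsets g i′ ≡ offsets g i + g i
offsets-step {suc k} g {F.zero}  {F.suc F.zero} refl = +-identityʳ (g F.zero)
offsets-step {suc k} g {F.suc i} {F.suc i′}    eq  =
  trans (cong (g F.zero +_) (offsets-step (g ∘ F.suc) (suc-injective eq))) (sym (+-assoc (g F.zero) _ _))

offsets-mono : ∀ {k} (g : Fin (suc k) → ℕ) {i i′ : Fin (suc k)} → toℕ i < toℕ i′
             → offsets g i + g i ≤ offsets g i′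
offsets-mono {suc k} g {F.zero}  {F.suc i′} _         = m≤m+n (g F.zero) _
offsets-mono {suc k} g {F.suc i} {F.suc i′} (s≤s i<i′) =
  subst (_≤ g F.zero + offsets (g ∘ F.suc) i′) (sym (+-assoc (g F.zero) _ _))
    (+-monoʳ-≤ (g F.zero) (offsets-mono (g ∘ F.suc) i<i′))

module EvenChainCycle (k : ℕ) (n : Fin (suc k) → ℕ) (n-even : ∀ i → 2 ∣ n i) (4≤n : ∀ i → 4 ≤ n i)
                           (N : ℕ) (π : CVert n → Fin N) (π-quotient : IsChainQuotient n π) where

  A : Graph N
  A = ChainCycle n π

  V : Set
  V = CVert n

  h : Fin (suc k) → ℕ
  h i = n i / 2

  n≡h+h : ∀ i → n i ≡ h i + h i
  n≡h+h i = sym (trans (cong (h i +_) (sym (+-identityʳ (h i)))) (trans (*-comm 2 (h i)) (m/n*n≡m (n-even i))))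

  2≤h : ∀ i → 2 ≤ h i
  2≤h i = *-cancelˡ-≤ 2 (subst (4 ≤_) (trans (sym (m/n*n≡m (n-even i))) (*-comm (h i) 2)) (4≤n i))

  h<n : ∀ i → h i < n i
  h<n i = subst (h i <_) (sym (n≡h+h i)) (subst (_≤ h i + h i) (+-comm (h i) 1) (+-monoʳ-≤ (h i) (≤-trans (s≤s z≤n) (2≤h i))))

  0<n : ∀ i → 0 < n i
  0<n i = ≤-<-trans z≤n (h<n i)

  δ : Fin (suc k) → ℕ → ℕ
  δ i = cycDist (n i)

  start pole : ∀ i → Fin (n i)
  start i = fromℕ< (0<n i)
  pole  i = fromℕ< (h<n i)

  toℕ-start : ∀ i → toℕ (start i) ≡ 0
  toℕ-start i = FP.toℕ-fromℕ< (0<n i)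

  toℕ-pole : ∀ i → toℕ (pole i) ≡ h i
  toℕ-pole i = FP.toℕ-fromℕ< (h<n i)

  offset : Fin (suc k) → ℕ
  offset = offsets h

  -- depth x is the distance of x from the first vertex v¹₁ of the chain.
  depth : V → ℕ
  depth (i , j) = offset i + δ i (toℕ j)

  -- D x y is the distance between π x and π y (see dist).
  D : V → V → ℕ
  D (i , j) (i′ , j′) with i F.≟ i′
  ... | yes refl = δ i ∣ toℕ j - toℕ j′ ∣
  ... | no  _    = ∣ depth (i , j) - depth (i′ , j′) ∣

  D-same : ∀ i (j j′ : Fin (n i)) → D (i , j) (i , j′) ≡ δ i ∣ toℕ j - toℕ j′ ∣
  D-same i j j′ with i F.≟ i
  ... | yes refl = refl
  ... | no  i≢i  = ⊥-elim (i≢i refl)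

  D-diff : ∀ {i i′} (j : Fin (n i)) (j′ : Fin (n i′)) → i ≢ i′ → D (i , j) (i′ , j′) ≡ ∣ depth (i , j) - depth (i′ , j′) ∣
  D-diff {i} {i′} j j′ i≢i′ with i F.≟ i′
  ... | yes refl = ⊥-elim (i≢i′ refl)
  ... | no  _    = refl

  D-sym : ∀ x y → D x y ≡ D y x
  D-sym (i , j) (i′ , j′) with i F.≟ i′
  ... | yes refl = trans (cong (δ i) (∣-∣-comm (toℕ j) (toℕ j′))) (sym (D-same i j′ j))
  ... | no  i≢i′ = trans (∣-∣-comm (depth (i , j)) _) (sym (D-diff j′ j (i≢i′ ∘ sym)))

  module Even (i : Fin (suc k)) = EvenCycle {n i} {h i} (n≡h+h i)

  δ≤h : ∀ i e → δ i e ≤ h i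
  δ≤h i = Even.cycDist≤h i

  toℕ<⇒≢ : ∀ {i i′ : Fin (suc k)} → toℕ i < toℕ i′ → i ≢ i′
  toℕ<⇒≢ i<i′ refl = <-irrefl refl i<i′

  depth≤offset+h : ∀ i {i′} (j′ : Fin (n i′)) → toℕ i′ ≤ toℕ i → depth (i′ , j′) ≤ offset i + h i
  depth≤offset+h i {i′} j′ i′≤i with toℕ i′ ≟ toℕ i
  ... | yes eq rewrite FP.toℕ-injective {i = i′} {j = i} eq = +-monoʳ-≤ (offset i) (δ≤h i _)
  ... | no  ne = ≤-trans (+-monoʳ-≤ (offset i′) (δ≤h i′ _))
                   (≤-trans (offsets-mono h (≤∧≢⇒< i′≤i ne)) (m≤m+n (offset i) (h i)))

  offset+h≤depth : ∀ i {i′} (j′ : Fin (n i′)) → toℕ i < toℕ i′ → offset i + h i ≤ depth (i′ , j′)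
  offset+h≤depth i j′ i<i′ = ≤-trans (offsets-mono h i<i′) (m≤m+n _ _)

  depth-mono : ∀ {i i′} (j : Fin (n i)) (j′ : Fin (n i′)) → toℕ i < toℕ i′ → depth (i , j) ≤ depth (i′ , j′)
  depth-mono {i} j j′ i<i′ = ≤-trans (depth≤offset+h i j ≤-refl) (offset+h≤depth i j′ i<i′)

  D-later : ∀ {i i′} (j : Fin (n i)) (j′ : Fin (n i′)) → toℕ i < toℕ i′
          → D (i , j) (i′ , j′) ≡ depth (i′ , j′) ∸ depth (i , j)
  D-later j j′ i<i′ = trans (D-diff j j′ (toℕ<⇒≢ i<i′)) (m≤n⇒∣m-n∣≡n∸m (depth-mono j j′ i<i′))

  D-earlier : ∀ {i i′} (j : Fin (n i)) (j′ : Fin (n i′)) → toℕ i′ < toℕ i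
            → D (i , j) (i′ , j′) ≡ depth (i , j) ∸ depth (i′ , j′)
  D-earlier j j′ i′<i = trans (D-diff j j′ (toℕ<⇒≢ i′<i ∘ sym)) (m≤n⇒∣n-m∣≡n∸m (depth-mono j′ j i′<i))

  depth-pole : ∀ i → depth (i , pole i) ≡ offset i + h i
  depth-pole i = cong (offset i +_) (trans (cong (δ i) (toℕ-pole i)) (Even.cycDist-h i))

  D-from-pole : ∀ i {i′} (j′ : Fin (n i′)) → toℕ i′ ≤ toℕ i → D (i , pole i) (i′ , j′) ≡ offset i + h i ∸ depth (i′ , j′)
  D-from-pole i {i′} j′ i′≤i with i F.≟ i′
  ... | yes refl = begin
    δ i ∣ toℕ (pole i) - toℕ j′ ∣        ≡⟨ cong (λ x → δ i ∣ x - toℕ j′ ∣) (toℕ-pole i) ⟩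
    δ i ∣ h i - toℕ j′ ∣                 ≡⟨ cong (δ i) (∣-∣-comm (h i) (toℕ j′)) ⟩
    δ i ∣ toℕ j′ - h i ∣                 ≡⟨ Even.cycDist-antipode i (FP.toℕ<n j′) ⟩
    h i ∸ δ i (toℕ j′)                   ≡⟨ sym ([m+n]∸[m+o]≡n∸o (offset i) (h i) _) ⟩
    offset i + h i ∸ depth (i , j′)      ∎
    where open ≡-Reasoning
  ... | no i≢i′ = trans (cong (λ x → ∣ x - depth (i′ , j′) ∣) (depth-pole i))
                    (m≤n⇒∣n-m∣≡n∸m (depth≤offset+h i j′ i′≤i))

  section : Fin N → V
  section u = proj₁ (proj₁ π-quotient u)

  π-section : ∀ u → π (section u) ≡ u
  π-section u = proj₂ (proj₁ π-quotient u)

  π⇒EqClosure : ∀ {x y} → π x ≡ π y → EqClosure (Ident n) x y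
  π⇒EqClosure {x} {y} = proj₁ (proj₂ π-quotient x y)

  EqClosure⇒π : ∀ {x y} → EqClosure (Ident n) x y → π x ≡ π y
  EqClosure⇒π {x} {y} = proj₂ (proj₂ π-quotient x y)

  π-isolated : ∀ {x y} → Isolated {R = Ident n} x → π y ≡ π x → y ≡ x
  π-isolated x-iso πy≡πx = EqClosure-isolated x-iso (π⇒EqClosure πy≡πx) (inj₂ refl)

  interior-isolated : ∀ i (j : Fin (n i)) → toℕ j ≢ 0 → toℕ j ≢ h i → Isolated {R = Ident n} (i , j)
  interior-isolated i j j≢0 j≢h = (λ { y (_ , j≡h , _) → j≢h j≡h }) , (λ { y (_ , _ , j≡0) → j≢0 j≡0 })

  depth-resp : ∀ {x y} → Ident n x y → depth x ≡ depth y
  depth-resp {i , j} {i′ , j′} (i′≡1+i , j≡h , j′≡0) = begin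
    offset i + δ i (toℕ j)      ≡⟨ cong (λ x → offset i + δ i x) j≡h ⟩
    offset i + δ i (h i)        ≡⟨ cong (offset i +_) (Even.cycDist-h i) ⟩
    offset i + h i              ≡⟨ sym (offsets-step h i′≡1+i) ⟩
    offset i′                   ≡⟨ sym (+-identityʳ (offset i′)) ⟩
    offset i′ + δ i′ 0          ≡⟨ cong (λ x → offset i′ + δ i′ x) (sym j′≡0) ⟩
    offset i′ + δ i′ (toℕ j′)   ∎
    where open ≡-Reasoning

  D-resp-by-cycle : ∀ {i₀ i i′} (j₀ : Fin (n i₀)) (j : Fin (n i)) (j′ : Fin (n i′)) → Dec (i₀ ≡ i) → Dec (i₀ ≡ i′)
                  → Ident n (i , j) (i′ , j′) → D (i₀ , j₀) (i , j) ≡ D (i₀ , j₀) (i′ , j′)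
  D-resp-by-cycle {i₀} j₀ j j′ (yes refl) (yes refl) (i′≡1+i , _) = ⊥-elim (<-irrefl i′≡1+i (n<1+n (toℕ i₀)))
  D-resp-by-cycle {i₀} {i′ = i′} j₀ j j′ (yes refl) (no _) y∼y′@(i′≡1+i , j≡h , _) = begin
    D (i₀ , j₀) (i₀ , j)               ≡⟨ D-sym (i₀ , j₀) (i₀ , j) ⟩
    D (i₀ , j) (i₀ , j₀)               ≡⟨ cong (λ y → D (i₀ , y) (i₀ , j₀)) j≡pole ⟩
    D (i₀ , pole i₀) (i₀ , j₀)         ≡⟨ D-from-pole i₀ j₀ ≤-refl ⟩
    offset i₀ + h i₀ ∸ depth (i₀ , j₀) ≡⟨ cong (_∸ depth (i₀ , j₀)) offset+h≡depth′ ⟩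
    depth (i′ , j′) ∸ depth (i₀ , j₀)  ≡⟨ sym (D-later j₀ j′ (≤-reflexive (sym i′≡1+i))) ⟩
    D (i₀ , j₀) (i′ , j′)              ∎
    where
    open ≡-Reasoning
    j≡pole : j ≡ pole i₀
    j≡pole = FP.toℕ-injective (trans j≡h (sym (toℕ-pole i₀)))
    offset+h≡depth′ : offset i₀ + h i₀ ≡ depth (i′ , j′)
    offset+h≡depth′ = trans (sym (depth-pole i₀)) (trans (cong (λ y → depth (i₀ , y)) (sym j≡pole)) (depth-resp y∼y′))
  D-resp-by-cycle {i₀} {i} j₀ j j′ (no _) (yes refl) y∼y′@(i₀≡1+i , _ , j′≡0) = begin
    D (i₀ , j₀) (i , j)                 ≡⟨ D-earlier j₀ j (≤-reflexive (sym i₀≡1+i)) ⟩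
    depth (i₀ , j₀) ∸ depth (i , j)     ≡⟨ cong (depth (i₀ , j₀) ∸_) (depth-resp y∼y′) ⟩
    depth (i₀ , j₀) ∸ depth (i₀ , j′)   ≡⟨ cong (λ x → depth (i₀ , j₀) ∸ (offset i₀ + δ i₀ x)) j′≡0 ⟩
    depth (i₀ , j₀) ∸ (offset i₀ + 0)   ≡⟨ cong (depth (i₀ , j₀) ∸_) (+-identityʳ (offset i₀)) ⟩
    depth (i₀ , j₀) ∸ offset i₀         ≡⟨ m+n∸m≡n (offset i₀) _ ⟩
    δ i₀ (toℕ j₀)                       ≡⟨ cong (δ i₀) (sym (∣-∣-identityʳ (toℕ j₀))) ⟩
    δ i₀ ∣ toℕ j₀ - 0 ∣                 ≡⟨ cong (λ x → δ i₀ ∣ toℕ j₀ - x ∣) (sym j′≡0) ⟩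
    δ i₀ ∣ toℕ j₀ - toℕ j′ ∣            ≡⟨ sym (D-same i₀ j₀ j′) ⟩
    D (i₀ , j₀) (i₀ , j′)               ∎
    where open ≡-Reasoning
  D-resp-by-cycle {i₀} {i} {i′} j₀ j j′ (no i₀≢i) (no i₀≢i′) y∼y′ = begin
    D (i₀ , j₀) (i , j)                       ≡⟨ D-diff j₀ j i₀≢i ⟩
    ∣ depth (i₀ , j₀) - depth (i , j) ∣       ≡⟨ cong (∣ depth (i₀ , j₀) -_∣) (depth-resp y∼y′) ⟩
    ∣ depth (i₀ , j₀) - depth (i′ , j′) ∣     ≡⟨ sym (D-diff j₀ j′ i₀≢i′) ⟩
    D (i₀ , j₀) (i′ , j′)                     ∎
    where open ≡-Reasoning

  D-resp : ∀ x {y y′} → Ident n y y′ → D x y ≡ D x y′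
  D-resp (i₀ , j₀) {i , j} {i′ , j′} = D-resp-by-cycle j₀ j j′ (i₀ F.≟ i) (i₀ F.≟ i′)

  D-self : ∀ x → D x x ≡ 0
  D-self (i , j) = trans (D-same i j j) (cong (δ i) (∣n-n∣≡0 (toℕ j)))

  D-step≈₁ : ∀ x {y y′} → DisjAdj n y y′ → D x y ≈₁ D x y′
  D-step≈₁ (i₀ , j₀) (adj {i} {j} {j′} j∼j′) = by-cycle (i₀ F.≟ i)
    where
    by-cycle : Dec (i₀ ≡ i) → D (i₀ , j₀) (i , j) ≈₁ D (i₀ , j₀) (i , j′)
    by-cycle (yes refl) = subst₂ _≈₁_
      (sym (trans (D-same i₀ j₀ j) (cong (δ i₀) (∣-∣-comm (toℕ j₀) (toℕ j)))))
      (sym (trans (D-same i₀ j₀ j′) (cong (δ i₀) (∣-∣-comm (toℕ j₀) (toℕ j′)))))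
      (cycleAdj≈₁ (toℕ j₀) (<⇒≤ (FP.toℕ<n j₀)) j∼j′)
    by-cycle (no i₀≢i) = subst₂ _≈₁_ (sym (D-diff j₀ j i₀≢i)) (sym (D-diff j₀ j′ i₀≢i))
      (∣-∣-≈₁ (depth (i₀ , j₀)) (+-≈₁ (offset i)
        (subst₂ _≈₁_ (cong (δ i) (∣-∣-identityʳ _)) (cong (δ i) (∣-∣-identityʳ _)) (cycleAdj≈₁ 0 z≤n j∼j′))))

  D-resp-EqClosure : ∀ x {y y′} → EqClosure (Ident n) y y′ → D x y ≡ D x y′
  D-resp-EqClosure x = EqClosure-resp (D x) (D-resp x)

  -- u ↦ D x (section u) grows by at most one along each edge, so it bounds walk lengths.
  D≤walk : ∀ x y {a} → Walk A (π x) (π y) a → D x y ≤ a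
  D≤walk x y {a} w = subst₂ _≤_ (φ-π y) (trans (cong (a +_) (trans (φ-π x) (D-self x))) (+-identityʳ a))
                       (potential≤walk φ φ-step w)
    where
    φ : Fin N → ℕ
    φ u = D x (section u)
    φ-π : ∀ y → φ (π y) ≡ D x y
    φ-π y = D-resp-EqClosure x (π⇒EqClosure (π-section (π y)))
    φ-step : ∀ {u w} → A u w → φ w ≤ suc (φ u)
    φ-step (y , y′ , refl , refl , y∼y′) = subst₂ (λ a b → a ≤ suc b) (sym (φ-π y′)) (sym (φ-π y)) (proj₂ (D-step≈₁ x y∼y′))

  A-sym : ∀ {u w} → A u w → A w u
  A-sym (x , y , πx≡u , πy≡w , adj x∼y) = y , x , πy≡w , πx≡u , adj (swap x∼y)

  edge : ∀ {x y} → DisjAdj n x y → A (π x) (π y)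
  edge x∼y = _ , _ , refl , refl , x∼y

  inCycleWalk : ∀ i (j j′ : Fin (n i)) → Walk A (π (i , j)) (π (i , j′)) (δ i ∣ toℕ j - toℕ j′ ∣)
  inCycleWalk i = cycleWalk A-sym (λ j → π (i , j)) (λ j→j′ → edge (adj (inj₁ j→j′)))

  nextCycle : (i : Fin (suc k)) → toℕ i < k → Fin (suc k)
  nextCycle i i<k = fromℕ< (s≤s i<k)

  toℕ-nextCycle : ∀ (i : Fin (suc k)) (i<k : toℕ i < k) → toℕ (nextCycle i i<k) ≡ suc (toℕ i)
  toℕ-nextCycle i i<k = FP.toℕ-fromℕ< (s≤s i<k)

  offset-nextCycle : ∀ (i : Fin (suc k)) (i<k : toℕ i < k) → offset (nextCycle i i<k) ≡ offset i + h i
  offset-nextCycle i i<k = offsets-step h (toℕ-nextCycle i i<k)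

  π-pole≡π-start : ∀ (i : Fin (suc k)) (i<k : toℕ i < k) → π (i , pole i) ≡ π (nextCycle i i<k , start (nextCycle i i<k))
  π-pole≡π-start i i<k = EqClosure⇒π (base (toℕ-nextCycle i i<k , toℕ-pole i , toℕ-start _))

  depth-start : ∀ i → depth (i , start i) ≡ offset i
  depth-start i = trans (cong (λ x → offset i + δ i x) (toℕ-start i)) (+-identityʳ (offset i))

  startWalk : ∀ {i i′} → i ≡ i′ → (j : Fin (n i′)) → Walk A (π (i , start i)) (π (i′ , j)) (depth (i′ , j) ∸ offset i)
  startWalk {i} refl j = subst (Walk A _ _) (begin
    δ i ∣ toℕ (start i) - toℕ j ∣    ≡⟨ cong (λ x → δ i ∣ x - toℕ j ∣) (toℕ-start i) ⟩
    δ i (toℕ j)                      ≡⟨ sym (m+n∸m≡n (offset i) _) ⟩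
    depth (i , j) ∸ offset i         ∎) (inCycleWalk i (start i) j)
    where open ≡-Reasoning

  crossWalk : ∀ d {i i′} (j : Fin (n i)) (j′ : Fin (n i′)) → toℕ i′ ≡ suc (d + toℕ i)
            → Walk A (π (i , j)) (π (i′ , j′)) (depth (i′ , j′) ∸ depth (i , j))
  crossWalk d {i} {i′} j j′ i′≡1+d+i = subst (Walk A _ _) length-eq
    (inCycleWalk i j (pole i) ++ʷ subst (λ u → Walk A u (π (i′ , j′)) (depth (i′ , j′) ∸ offset i₁)) (sym (π-pole≡π-start i i<k))
                                           (onward d i′≡1+d+i))
    where
    i<i′ : toℕ i < toℕ i′
    i<i′ = subst (toℕ i <_) (sym i′≡1+d+i) (s≤s (m≤n+m (toℕ i) d))
    i<k : toℕ i < k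
    i<k = ≤-trans i<i′ (≤-pred (FP.toℕ<n i′))
    i₁ : Fin (suc k)
    i₁ = nextCycle i i<k
    onward : ∀ d → toℕ i′ ≡ suc (d + toℕ i) → Walk A (π (i₁ , start i₁)) (π (i′ , j′)) (depth (i′ , j′) ∸ offset i₁)
    onward zero i′≡1+i = startWalk (FP.toℕ-injective (trans (toℕ-nextCycle i i<k) (sym i′≡1+i))) j′
    onward (suc d) i′≡2+d+i = subst (Walk A _ _) (cong (depth (i′ , j′) ∸_) (depth-start i₁))
      (crossWalk d (start i₁) j′ (trans i′≡2+d+i (cong suc (trans (sym (+-suc d (toℕ i))) (cong (d +_) (sym (toℕ-nextCycle i i<k)))))))
    length-eq : δ i ∣ toℕ j - toℕ (pole i) ∣ + (depth (i′ , j′) ∸ offset i₁) ≡ depth (i′ , j′) ∸ depth (i , j)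
    length-eq = begin
      δ i ∣ toℕ j - toℕ (pole i) ∣ + (depth (i′ , j′) ∸ offset i₁)
        ≡⟨ cong₂ (λ x y → δ i ∣ toℕ j - x ∣ + (depth (i′ , j′) ∸ y)) (toℕ-pole i) (offset-nextCycle i i<k) ⟩
      δ i ∣ toℕ j - h i ∣ + (depth (i′ , j′) ∸ (offset i + h i))
        ≡⟨ cong (_+ (depth (i′ , j′) ∸ (offset i + h i))) (Even.cycDist-antipode i (FP.toℕ<n j)) ⟩
      (h i ∸ δ i (toℕ j)) + (depth (i′ , j′) ∸ (offset i + h i))
        ≡⟨ [n∸m]+[o∸[p+n]]≡o∸[p+m] (δ≤h i _) (offset+h≤depth i j′ i<i′) ⟩
      depth (i′ , j′) ∸ depth (i , j)  ∎
      where open ≡-Reasoning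

  forwardCrossWalk : ∀ {i i′} (j : Fin (n i)) (j′ : Fin (n i′)) → toℕ i < toℕ i′
                   → Walk A (π (i , j)) (π (i′ , j′)) (depth (i′ , j′) ∸ depth (i , j))
  forwardCrossWalk {i} {i′} j j′ i<i′ = crossWalk (toℕ i′ ∸ suc (toℕ i)) j j′
    (sym (trans (sym (+-suc _ (toℕ i))) (m∸n+n≡m i<i′)))

  walk : ∀ x y → Walk A (π x) (π y) (D x y)
  walk (i , j) (i′ , j′) = by-cycle (i F.≟ i′)
    where
    by-cycle : Dec (i ≡ i′) → Walk A (π (i , j)) (π (i′ , j′)) (D (i , j) (i′ , j′))
    by-cycle (yes refl) = subst (Walk A _ _) (sym (D-same i j j′)) (inCycleWalk i j j′)
    by-cycle (no i≢i′) with <-cmp (toℕ i) (toℕ i′)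
    ... | tri< i<i′ _ _ = subst (Walk A _ _) (sym (D-later j j′ i<i′)) (forwardCrossWalk j j′ i<i′)
    ... | tri≈ _ i≡i′ _ = ⊥-elim (i≢i′ (FP.toℕ-injective i≡i′))
    ... | tri> _ _ i′<i = subst (Walk A _ _) (sym (D-earlier j j′ i′<i)) (reverseʷ A-sym (forwardCrossWalk j′ j i′<i))

  dist : ∀ x y → Dist A (π x) (π y) (D x y)
  dist x y = walk x y , λ _ w → D≤walk x y w

  ¬MaxDistantFrom-via : ∀ {x x′ y} z → π x′ ≡ π x → DisjAdj n x′ y → D z y ≡ suc (D x z)
                      → ¬ MaxDistantFrom A (π x) (π z)
  ¬MaxDistantFrom-via {x} {x′} {y} z πx′≡πx x′∼y Dzy≡1+Dxz = farther-neighbour⇒¬MaxDistantFrom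
    (subst (λ u → A u (π y)) πx′≡πx (edge x′∼y)) (subst (Dist A (π z) (π y)) Dzy≡1+Dxz (dist z y)) (dist x z)

  farther-from-earlier : ∀ {i i′} (j j′ : Fin (n i)) (b : Fin (n i′)) → toℕ i′ < toℕ i
                       → δ i (toℕ j′) ≡ suc (δ i (toℕ j)) → D (i′ , b) (i , j′) ≡ suc (D (i , j) (i′ , b))
  farther-from-earlier {i} {i′} j j′ b i′<i δj′≡1+δj = begin
    D (i′ , b) (i , j′)                   ≡⟨ D-later b j′ i′<i ⟩
    depth (i , j′) ∸ depth (i′ , b)       ≡⟨ cong (λ e → offset i + e ∸ depth (i′ , b)) δj′≡1+δj ⟩
    offset i + suc (δ i (toℕ j)) ∸ depth (i′ , b) ≡⟨ cong (_∸ depth (i′ , b)) (+-suc (offset i) _) ⟩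
    suc (depth (i , j)) ∸ depth (i′ , b)  ≡⟨ +-∸-assoc 1 (depth-mono b j i′<i) ⟩
    suc (depth (i , j) ∸ depth (i′ , b))  ≡⟨ cong suc (sym (D-earlier j b i′<i)) ⟩
    suc (D (i , j) (i′ , b))              ∎
    where open ≡-Reasoning

  farther-from-later : ∀ {i i′} (j j′ : Fin (n i)) (b : Fin (n i′)) → toℕ i < toℕ i′
                     → suc (δ i (toℕ j′)) ≡ δ i (toℕ j) → D (i′ , b) (i , j′) ≡ suc (D (i , j) (i′ , b))
  farther-from-later {i} {i′} j j′ b i<i′ 1+δj′≡δj = begin
    D (i′ , b) (i , j′)                    ≡⟨ D-earlier b j′ i<i′ ⟩
    depth (i′ , b) ∸ depth (i , j′)        ≡⟨ +-∸-assoc 1 1+depth≤ ⟩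
    suc (depth (i′ , b) ∸ suc (depth (i , j′))) ≡⟨ cong (λ e → suc (depth (i′ , b) ∸ e)) depth-j≡ ⟩
    suc (depth (i′ , b) ∸ depth (i , j))   ≡⟨ cong suc (sym (D-later j b i<i′)) ⟩
    suc (D (i , j) (i′ , b))               ∎
    where
    open ≡-Reasoning
    depth-j≡ : suc (depth (i , j′)) ≡ depth (i , j)
    depth-j≡ = trans (sym (+-suc (offset i) _)) (cong (offset i +_) 1+δj′≡δj)
    1+depth≤ : suc (depth (i , j′)) ≤ depth (i′ , b)
    1+depth≤ = subst (_≤ depth (i′ , b)) (sym depth-j≡) (depth-mono j b i<i′)

  sameCycle-¬MaxDistantFrom : ∀ i (a b : Fin (n i)) → δ i ∣ toℕ a - toℕ b ∣ < h i
                            → ¬ MaxDistantFrom A (π (i , a)) (π (i , b))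
  sameCycle-¬MaxDistantFrom i a b δ<h with Even.cycle-farther i a (toℕ b) (FP.toℕ<n b) δ<h
  ... | a′ , a∼a′ , δa′≡1+δa = ¬MaxDistantFrom-via (i , b) refl (adj a∼a′) (begin
    D (i , b) (i , a′)            ≡⟨ D-same i b a′ ⟩
    δ i ∣ toℕ b - toℕ a′ ∣        ≡⟨ cong (δ i) (∣-∣-comm (toℕ b) (toℕ a′)) ⟩
    δ i ∣ toℕ a′ - toℕ b ∣        ≡⟨ δa′≡1+δa ⟩
    suc (δ i ∣ toℕ a - toℕ b ∣)   ≡⟨ cong suc (sym (D-same i a b)) ⟩
    suc (D (i , a) (i , b))       ∎)
    where open ≡-Reasoning

  start-¬MaxDistantFrom : ∀ i {i′} (b : Fin (n i′)) → toℕ i′ < toℕ i → ¬ MaxDistantFrom A (π (i , start i)) (π (i′ , b))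
  start-¬MaxDistantFrom i b i′<i
    with Even.cycle-away-from-0 i (start i) (subst (λ e → δ i e < h i) (sym (toℕ-start i)) (≤-trans (s≤s z≤n) (2≤h i)))
  ... | a′ , s∼a′ , δa′≡1+δs = ¬MaxDistantFrom-via _ refl (adj s∼a′) (farther-from-earlier (start i) a′ b i′<i δa′≡1+δs)

  -- A pole is a cut vertex: a neighbour on the far side from z is farther from z.
  pole-¬MaxDistantFrom : ∀ i → toℕ i < k → ∀ z → ¬ MaxDistantFrom A (π (i , pole i)) (π z)
  pole-¬MaxDistantFrom i i<k (i′ , b) with toℕ i′ ≤? toℕ i
  ... | yes i′≤i = subst (λ u → ¬ MaxDistantFrom A u (π (i′ , b))) (sym (π-pole≡π-start i i<k))
    (start-¬MaxDistantFrom (nextCycle i i<k) b (subst (toℕ i′ <_) (sym (toℕ-nextCycle i i<k)) (s≤s i′≤i)))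
  pole-¬MaxDistantFrom i i<k (i′ , b) | no i′≰i
    with Even.cycle-toward-0 i (pole i) (subst (0 <_) (sym (toℕ-pole i)) (≤-trans (s≤s z≤n) (2≤h i)))
  ... | a′ , p∼a′ , 1+δa′≡δp = ¬MaxDistantFrom-via (i′ , b) refl (adj p∼a′) (farther-from-later (pole i) a′ b (≰⇒> i′≰i) 1+δa′≡δp)

  farHalf-¬MaxDistantFrom : ∀ i (a : Fin (n i)) → h i < toℕ a → ∀ {i′} (b : Fin (n i′)) → toℕ b ≡ 0 ⊎ h i′ ≤ toℕ b
                          → ¬ MaxDistantFrom A (π (i , a)) (π (i′ , b))
  farHalf-¬MaxDistantFrom i a h<a {i′} b b-far with <-cmp (toℕ i) (toℕ i′)
  ... | tri< i<i′ _ _ with Even.cycle-toward-0 i a (≤-<-trans z≤n h<a)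
  ...   | a′ , a∼a′ , 1+δa′≡δa = ¬MaxDistantFrom-via (i′ , b) refl (adj a∼a′) (farther-from-later a a′ b i<i′ 1+δa′≡δa)
  farHalf-¬MaxDistantFrom i a h<a {i′} b b-far | tri> _ _ i′<i
    with Even.cycle-away-from-0 i a (subst (_< h i) (cong (δ i) (∣-∣-identityʳ (toℕ a)))
           (Even.cycDist-farHalf< i h<a (FP.toℕ<n a) (inj₁ refl) (0<n i)))
  ... | a′ , a∼a′ , δa′≡1+δa = ¬MaxDistantFrom-via (i′ , b) refl (adj a∼a′) (farther-from-earlier a a′ b i′<i δa′≡1+δa)
  farHalf-¬MaxDistantFrom i a h<a {i′} b b-far | tri≈ _ i≡i′ _ with FP.toℕ-injective {i = i} {j = i′} i≡i′
  ... | refl = sameCycle-¬MaxDistantFrom i a b (Even.cycDist-farHalf< i h<a (FP.toℕ<n a) b-far (FP.toℕ<n b))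

  lastCycle : Fin (suc k)
  lastCycle = F.fromℕ k

  root top : V
  root = F.zero , start F.zero
  top  = lastCycle , pole lastCycle

  _≟V_ : (x y : V) → Dec (x ≡ y)
  _≟V_ = ≡-dec FP._≟_ FP._≟_

  -- The vertices outside the cover: starts of cycles other than the first (these are
  -- poles of the previous cycle) and the far halves of the cycles, poles included.
  Uncovered : V → Set
  Uncovered (i , j) = (toℕ j ≡ 0 × toℕ i ≢ 0) ⊎ h i ≤ toℕ j

  uncovered-far : ∀ {i} (j : Fin (n i)) → Uncovered (i , j) → toℕ j ≡ 0 ⊎ h i ≤ toℕ j
  uncovered-far j (inj₁ (j≡0 , _)) = inj₁ j≡0
  uncovered-far j (inj₂ h≤j)       = inj₂ h≤j

  previousPole : ∀ (i : Fin (suc k)) (j : Fin (n i)) → toℕ j ≡ 0 → toℕ i ≢ 0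
               → ∃ λ i₀ → toℕ i₀ < k × π (i₀ , pole i₀) ≡ π (i , j)
  previousPole F.zero    j j≡0 i≢0 = ⊥-elim (i≢0 refl)
  previousPole (F.suc i) j j≡0 i≢0 = F.inject₁ i , subst (_< k) (sym (FP.toℕ-inject₁ i)) (FP.toℕ<n i) ,
    EqClosure⇒π (base (cong suc (sym (FP.toℕ-inject₁ i)) , toℕ-pole _ , j≡0))

  uncovered-¬MaxDistantFrom : ∀ x z → Uncovered x → x ≢ top → Uncovered z → ¬ MaxDistantFrom A (π x) (π z)
  uncovered-¬MaxDistantFrom (i , j) z (inj₁ (j≡0 , i≢0)) _ _ with previousPole i j j≡0 i≢0
  ... | i₀ , i₀<k , π-eq = subst (λ u → ¬ MaxDistantFrom A u (π z)) π-eq (pole-¬MaxDistantFrom i₀ i₀<k z)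
  uncovered-¬MaxDistantFrom (i , j) (i′ , b) (inj₂ h≤j) ¬top z-unc with toℕ j ≟ h i
  ... | no j≢h = farHalf-¬MaxDistantFrom i j (≤∧≢⇒< h≤j (j≢h ∘ sym)) b (uncovered-far b z-unc)
  ... | yes j≡h = subst (λ a → ¬ MaxDistantFrom A (π (i , a)) (π (i′ , b))) (sym (j≡pole j≡h))
                    (pole-¬MaxDistantFrom i (≤∧≢⇒< (≤-pred (FP.toℕ<n i)) i≢k) (i′ , b))
    where
    j≡pole : ∀ {i} {j : Fin (n i)} → toℕ j ≡ h i → j ≡ pole i
    j≡pole j≡h = FP.toℕ-injective (trans j≡h (sym (toℕ-pole _)))
    i≢k : toℕ i ≢ k
    i≢k i≡k with FP.toℕ-injective {i = i} {j = lastCycle} (trans i≡k (sym (FP.toℕ-fromℕ k)))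
    ... | refl = ¬top (cong (lastCycle ,_) (j≡pole j≡h))

  ¬MaxDistantFrom-self : ∀ x → ¬ MaxDistantFrom A (π x) (π x)
  ¬MaxDistantFrom-self (i , j) = sameCycle-¬MaxDistantFrom i j j
    (subst (λ e → δ i e < h i) (sym (∣n-n∣≡0 (toℕ j))) (≤-trans (s≤s z≤n) (2≤h i)))

  uncovered-¬MutuallyMaxDistant : ∀ x z → Uncovered x → Uncovered z → ¬ MutuallyMaxDistant A (π x) (π z)
  uncovered-¬MutuallyMaxDistant x z x-unc z-unc (x-md , z-md) with x ≟V top | z ≟V top
  ... | no x≢top | _        = uncovered-¬MaxDistantFrom x z x-unc x≢top z-unc x-md
  ... | yes _    | no z≢top = uncovered-¬MaxDistantFrom z x z-unc z≢top x-unc z-md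
  ... | yes refl | yes refl = ¬MaxDistantFrom-self top x-md

  MaxDistantFrom-bounded : ∀ x z → (∀ {x′ y} → π x′ ≡ π x → DisjAdj n x′ y → D z y ≤ D x z)
                         → MaxDistantFrom A (π x) (π z)
  MaxDistantFrom-bounded x z bound w (x′ , y , πx′≡πx , refl , x′∼y) a b d-zw d-xz =
    subst₂ _≤_ (Dist-unique (dist z y) d-zw) (Dist-unique (dist x z) d-xz) (bound πx′≡πx x′∼y)

  depth-root : depth root ≡ 0
  depth-root = depth-start F.zero

  D-root : ∀ y → D root y ≡ depth y
  D-root (F.zero  , j) = trans (D-same F.zero (start F.zero) j) (cong (λ x → δ F.zero ∣ x - toℕ j ∣) (toℕ-start F.zero))
  D-root (F.suc i , j) = trans (D-later (start F.zero) j (s≤s z≤n)) (cong (depth (F.suc i , j) ∸_) depth-root)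

  ≤lastCycle : ∀ (i : Fin (suc k)) → toℕ i ≤ toℕ lastCycle
  ≤lastCycle i = subst (toℕ i ≤_) (sym (FP.toℕ-fromℕ k)) (≤-pred (FP.toℕ<n i))

  D-top : ∀ y → D top y ≡ depth top ∸ depth y
  D-top (i , j) = trans (D-from-pole lastCycle j (≤lastCycle i)) (cong (_∸ depth (i , j)) (sym (depth-pole lastCycle)))

  depth≤depth-top : ∀ y → depth y ≤ depth top
  depth≤depth-top (i , j) = subst (depth (i , j) ≤_) (sym (depth-pole lastCycle)) (depth≤offset+h lastCycle j (≤lastCycle i))

  root-top-MMD : MutuallyMaxDistant A (π root) (π top)
  root-top-MMD =
    MaxDistantFrom-bounded root top (λ {_} {y} _ _ → subst₂ _≤_ (sym (D-top y)) (sym (D-root top)) (m∸n≤m _ (depth y))) ,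
    MaxDistantFrom-bounded top root (λ {_} {y} _ _ → subst₂ _≤_ (sym (D-root y)) D-top-root (depth≤depth-top y))
    where
    D-top-root : depth top ≡ D top root
    D-top-root = sym (trans (D-top root) (cong (depth top ∸_) depth-root))

  isolated-MaxDistantFrom : ∀ i (a b : Fin (n i)) → Isolated {R = Ident n} (i , a) → D (i , a) (i , b) ≡ h i
                          → MaxDistantFrom A (π (i , a)) (π (i , b))
  isolated-MaxDistantFrom i a b a-iso Dab≡h = MaxDistantFrom-bounded (i , a) (i , b) bound
    where
    bound : ∀ {x′ y} → π x′ ≡ π (i , a) → DisjAdj n x′ y → D (i , b) y ≤ D (i , a) (i , b)
    bound πx′≡πa x′∼y with π-isolated a-iso πx′≡πa
    bound πx′≡πa (adj {j′ = y} _) | refl = subst₂ _≤_ (sym (D-same i b y)) (sym Dab≡h) (δ≤h i _)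

  antipodal-MMD : ∀ i (a a⁺ : Fin (n i)) → 0 < toℕ a → toℕ a < h i → toℕ a⁺ ≡ toℕ a + h i
                → MutuallyMaxDistant A (π (i , a)) (π (i , a⁺))
  antipodal-MMD i a a⁺ 0<a a<h a⁺≡a+h =
    isolated-MaxDistantFrom i a a⁺ a-iso D≡h , isolated-MaxDistantFrom i a⁺ a a⁺-iso (trans (D-sym (i , a⁺) (i , a)) D≡h)
    where
    a-iso = interior-isolated i a (λ a≡0 → <⇒≢ 0<a (sym a≡0)) (<⇒≢ a<h)
    h<a⁺ : h i < toℕ a⁺
    h<a⁺ = subst (h i <_) (trans (+-comm (h i) _) (sym a⁺≡a+h)) (m<m+n (h i) 0<a)
    a⁺-iso = interior-isolated i a⁺ (λ a⁺≡0 → <⇒≢ (≤-<-trans z≤n h<a⁺) (sym a⁺≡0)) (λ a⁺≡h → <⇒≢ h<a⁺ (sym a⁺≡h))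
    D≡h : D (i , a) (i , a⁺) ≡ h i
    D≡h = begin
      D (i , a) (i , a⁺)             ≡⟨ D-same i a a⁺ ⟩
      δ i ∣ toℕ a - toℕ a⁺ ∣         ≡⟨ cong (λ x → δ i ∣ toℕ a - x ∣) a⁺≡a+h ⟩
      δ i ∣ toℕ a - toℕ a + h i ∣    ≡⟨ cong (δ i) (∣m-m+n∣≡n (toℕ a) (h i)) ⟩
      δ i (h i)                      ≡⟨ Even.cycDist-h i ⟩
      h i                            ∎
      where open ≡-Reasoning

  g : Fin (suc k) → ℕ
  g i = (n i ∸ 2) / 2

  g≡h∸1 : ∀ i → g i ≡ h i ∸ 1
  g≡h∸1 i = trans (cong (_/ 2) n∸2≡[h∸1]*2) (m*n/n≡m (h i ∸ 1) 2)
    where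
    n∸2≡[h∸1]*2 : n i ∸ 2 ≡ (h i ∸ 1) * 2
    n∸2≡[h∸1]*2 = trans (cong (_∸ 2) (sym (m/n*n≡m (n-even i)))) (sym (*-distribʳ-∸ 2 (h i) 1))

  Slot : Set
  Slot = Σ (Fin (suc k)) (Fin ∘ g)

  1+s<h : ∀ i (s : Fin (g i)) → suc (toℕ s) < h i
  1+s<h i s = subst (suc (toℕ s) <_) (m+[n∸m]≡n {1} (≤-trans (s≤s z≤n) (2≤h i)))
                (s≤s (subst (toℕ s <_) (g≡h∸1 i) (FP.toℕ<n s)))

  1+s+h<n : ∀ i (s : Fin (g i)) → suc (toℕ s) + h i < n i
  1+s+h<n i s = subst (suc (toℕ s) + h i <_) (sym (n≡h+h i)) (+-monoˡ-< (h i) (1+s<h i s))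

  -- Slot (i , s) is the antipodal pair v_{s+2}, v_{s+2+h} of cycle i (paper's indexing).
  near far : Slot → V
  near (i , s) = i , fromℕ< (<-trans (1+s<h i s) (h<n i))
  far  (i , s) = i , fromℕ< (1+s+h<n i s)

  toℕ-near : ∀ i (s : Fin (g i)) → toℕ (proj₂ (near (i , s))) ≡ suc (toℕ s)
  toℕ-near i s = FP.toℕ-fromℕ< (<-trans (1+s<h i s) (h<n i))

  toℕ-far : ∀ i (s : Fin (g i)) → toℕ (proj₂ (far (i , s))) ≡ suc (toℕ s) + h i
  toℕ-far i s = FP.toℕ-fromℕ< (1+s+h<n i s)

  M : ℕ
  M = sum (tabulate g)

  slot : Fin M → Slot
  slot = Inverse.to (sum↔Σ g)

  slot-injective : Injective _≡_ _≡_ slot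
  slot-injective {t} {t′} eq = trans (sym (Inverse.strictlyInverseʳ (sum↔Σ g) t))
    (trans (cong (Inverse.from (sum↔Σ g)) eq) (Inverse.strictlyInverseʳ (sum↔Σ g) t′))

  left right : Fin (suc M) → V
  left  F.zero    = root
  left  (F.suc t) = near (slot t)
  right F.zero    = top
  right (F.suc t) = far (slot t)

  left-right-MMD : ∀ t → MutuallyMaxDistant A (π (left t)) (π (right t))
  left-right-MMD F.zero    = root-top-MMD
  left-right-MMD (F.suc t) with slot t
  ... | i , s = antipodal-MMD i _ _ (subst (0 <_) (sym (toℕ-near i s)) (s≤s z≤n))
                  (subst (_< h i) (sym (toℕ-near i s)) (1+s<h i s))
                  (trans (toℕ-far i s) (cong (_+ h i) (sym (toℕ-near i s))))

  position : V → ℕ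
  position (i , j) = toℕ j

  left-near-half : ∀ t → position (left t) < h (proj₁ (left t))
  left-near-half F.zero = subst (_< h F.zero) (sym (toℕ-start F.zero)) (≤-trans (s≤s z≤n) (2≤h F.zero))
  left-near-half (F.suc t) with slot t
  ... | i , s = subst (_< h i) (sym (toℕ-near i s)) (1+s<h i s)

  right-far-half : ∀ t → h (proj₁ (right t)) ≤ position (right t)
  right-far-half F.zero = ≤-reflexive (sym (toℕ-pole lastCycle))
  right-far-half (F.suc t) with slot t
  ... | i , s = subst (h i ≤_) (sym (toℕ-far i s)) (m≤n+m (h i) _)

  left≢right : ∀ t t′ → left t ≢ right t′
  left≢right t t′ eq = <⇒≱ (left-near-half t)
    (subst₂ (λ i a → h i ≤ a) (sym (cong proj₁ eq)) (sym (cong position eq)) (right-far-half t′))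

  left-isolated : ∀ t → Isolated {R = Ident n} (left t)
  left-isolated F.zero = (λ { y (_ , 0≡h , _) → <⇒≢ (≤-trans (s≤s z≤n) (2≤h F.zero)) (trans (sym (toℕ-start F.zero)) 0≡h) })
                       , (λ { y (() , _ , _) })
  left-isolated (F.suc t) with slot t
  ... | i , s = interior-isolated i _ (λ e → 0≢1+n (sym (trans (sym (toℕ-near i s)) e)))
                  (λ e → <⇒≢ (1+s<h i s) (trans (sym (toℕ-near i s)) e))

  right-isolated : ∀ t → Isolated {R = Ident n} (right t)
  right-isolated F.zero =
    (λ { (i′ , _) (i′≡1+k , _ , _) → <⇒≢ (FP.toℕ<n i′) (trans i′≡1+k (cong suc (FP.toℕ-fromℕ k))) }) ,
    (λ { y (_ , _ , pole≡0) → <⇒≢ (≤-trans (s≤s z≤n) (2≤h lastCycle)) (sym (trans (sym (toℕ-pole lastCycle)) pole≡0)) })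
  right-isolated (F.suc t) with slot t
  ... | i , s = interior-isolated i _ (λ e → 0≢1+n (sym (trans (sym (toℕ-far i s)) e)))
                  (λ e → <⇒≢ (m<n+m (h i) (s≤s z≤n)) (sym (trans (sym (toℕ-far i s)) e)))

  near-injective : Injective _≡_ _≡_ near
  near-injective {i , s} {i′ , s′} eq with cong proj₁ eq
  ... | refl = cong (i ,_) (FP.toℕ-injective (suc-injective
                 (trans (sym (toℕ-near i s)) (trans (cong position eq) (toℕ-near i s′)))))

  far-injective : Injective _≡_ _≡_ far
  far-injective {i , s} {i′ , s′} eq with cong proj₁ eq
  ... | refl = cong (i ,_) (FP.toℕ-injective (suc-injective (+-cancelʳ-≡ (h i) _ _
                 (trans (sym (toℕ-far i s)) (trans (cong position eq) (toℕ-far i s′))))))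

  position-near : ∀ p → position (near p) ≡ suc (toℕ (proj₂ p))
  position-near (i , s) = toℕ-near i s

  position-far : ∀ p → position (far p) ≡ suc (toℕ (proj₂ p)) + h (proj₁ p)
  position-far (i , s) = toℕ-far i s

  left-injective : Injective _≡_ _≡_ left
  left-injective {F.zero}  {F.zero}   eq = refl
  left-injective {F.zero}  {F.suc t′} eq =
    ⊥-elim (0≢1+n (trans (sym (toℕ-start F.zero)) (trans (cong position eq) (position-near (slot t′)))))
  left-injective {F.suc t} {F.zero}   eq = sym (left-injective (sym eq))
  left-injective {F.suc t} {F.suc t′} eq = cong F.suc (slot-injective (near-injective eq))

  right-injective : Injective _≡_ _≡_ right
  right-injective {F.zero}  {F.zero}   eq = refl
  right-injective {F.zero}  {F.suc t′} eq = ⊥-elim (m≢1+n+m (h lastCycle) (begin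
    h lastCycle                              ≡⟨ sym (toℕ-pole lastCycle) ⟩
    position top                             ≡⟨ cong position eq ⟩
    position (far (slot t′))                 ≡⟨ position-far (slot t′) ⟩
    suc (toℕ (proj₂ (slot t′))) + h (proj₁ (slot t′)) ≡⟨ cong (λ i → suc (toℕ (proj₂ (slot t′))) + h i) (sym (cong proj₁ eq)) ⟩
    suc (toℕ (proj₂ (slot t′)) + h lastCycle) ∎))
    where open ≡-Reasoning
  right-injective {F.suc t} {F.zero}   eq = sym (right-injective (sym eq))
  right-injective {F.suc t} {F.suc t′} eq = cong F.suc (slot-injective (far-injective eq))

  πleft-injective : Injective _≡_ _≡_ (π ∘ left)
  πleft-injective {t} {t′} eq = left-injective (π-isolated (left-isolated t′) eq)

  πright-injective : Injective _≡_ _≡_ (π ∘ right)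
  πright-injective {t} {t′} eq = right-injective (π-isolated (right-isolated t′) eq)

  πleft≢πright : ∀ t t′ → π (left t) ≢ π (right t′)
  πleft≢πright t t′ eq = left≢right t t′ (π-isolated (right-isolated t′) eq)

  root-unique : ∀ {i} (j : Fin (n i)) → toℕ i ≡ 0 → toℕ j ≡ 0 → (i , j) ≡ root
  root-unique {F.zero} j _ j≡0 = cong (F.zero ,_) (FP.toℕ-injective (trans j≡0 (sym (toℕ-start F.zero))))

  near-onto : ∀ i (j : Fin (n i)) → 0 < toℕ j → toℕ j < h i → ∃ λ t → left t ≡ (i , j)
  near-onto i j 0<j j<h = F.suc (Inverse.from (sum↔Σ g) (i , s)) ,
    trans (cong near (Inverse.strictlyInverseˡ (sum↔Σ g) (i , s)))
      (cong (i ,_) (FP.toℕ-injective (trans (toℕ-near i s) (trans (cong suc (FP.toℕ-fromℕ< j∸1<g)) (m+[n∸m]≡n 0<j)))))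
    where
    j∸1<g : toℕ j ∸ 1 < g i
    j∸1<g = subst (toℕ j ∸ 1 <_) (sym (g≡h∸1 i)) (∸-monoˡ-< j<h 0<j)
    s : Fin (g i)
    s = fromℕ< j∸1<g

  uncovered : ∀ x → (∀ t → π (left t) ≢ π x) → Uncovered x
  uncovered (i , j) ∉left with h i ≤? toℕ j | toℕ j ≟ 0 | toℕ i ≟ 0
  ... | yes h≤j | _       | _       = inj₂ h≤j
  ... | no _    | yes j≡0 | no i≢0  = inj₁ (j≡0 , i≢0)
  ... | no _    | yes j≡0 | yes i≡0 = ⊥-elim (∉left F.zero (cong π (sym (root-unique j i≡0 j≡0))))
  ... | no h≰j  | no j≢0  | _       =
    ⊥-elim (∉left (proj₁ onto) (cong π (proj₂ onto)))
    where onto = near-onto i j (n≢0⇒n>0 j≢0) (≰⇒> h≰j)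

  MMD-meets-left : ∀ {u v} → MutuallyMaxDistant A u v → (∀ t → π (left t) ≢ u) → (∀ t → π (left t) ≢ v) → ⊥
  MMD-meets-left {u} {v} mmd u∉ v∉ = uncovered-¬MutuallyMaxDistant (section u) (section v)
    (uncovered (section u) (λ t eq → u∉ t (trans eq (π-section u))))
    (uncovered (section v) (λ t eq → v∉ t (trans eq (π-section v))))
    (subst₂ (MutuallyMaxDistant A) (sym (π-section u)) (sym (π-section v)) mmd)

lemma3p4 : (k : ℕ) (n : Fin (suc k) → ℕ)
    → (∀ i → 2 ∣ n i) → (∀ i → 4 ≤ n i)
    → (N : ℕ) (π : CVert n → Fin N) → IsChainQuotient n π
    → VertexCoverNumber (StrongResolvingGraph (ChainCycle n π))
        (1 + sum (tabulate (λ i → (n i ∸ 2) / 2)))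
lemma3p4 k n n-even 4≤n N π π-quotient =
  matching⇒VertexCoverNumber (StrongResolvingGraph A) (π ∘ left) (π ∘ right)
    left-right-MMD πleft-injective πright-injective πleft≢πright MMD-meets-left
  where open EvenChainCycle k n n-even 4≤n N π π-quotient
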